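{- Let $r\ge 3$ and $1\le s\le q$ be integers. Let $U$ and $V$ be subsets of $U_r$, each of size at least $s$. Then there exist vertex-disjoint $U$--$V$ paths $Q_1,\dots,Q_s$ in $\mathcal{H}_q^r$ such that for each $i\in[s]$, $Q_i$ is a path in $\mathcal{H}_i$.
   Context: Let $[q]=\{1,\dots,q\}$ and $\alpha$ a symbol not in $[q]$. $V(q,r,\alpha)$ is the set of $r$-tuples with exactly one entry equal to $\alpha$ and all others in $[q]$. $\mathcal{H}_q^r$ is the $r$-uniform hypergraph on $V(q,r,\alpha)$ whose edges are indexed by $e\in[q]^r$, the edge $e$ consisting of the $r$ tuples obtained from $e$ by replacing exactly one entry by $\alpha$. Define $W_i=\{(n_1,\dots,n_r)\in V(q,r,\alpha): n_r=i\}$ for $i\in[q]$, $U_r=\{(m_1,\dots,m_r)\in V(q,r,\alpha): m_r=\alpha\}$, and $\mathcal{H}_i=\mathcal{H}_q^r[W_i\cup U_r]$, the induced subhypergraph (edges of $\mathcal{H}_q^r$ contained in $W_i\cup U_r$). In a linear hypergraph, a path is an alternating sequence $v_0e_1v_1\cdots e_\ell v_\ell$ of vertices and edges with $\{v_i,v_{i+1}\}\subseteq e_{i+1}$ and any two non-consecutive edges disjoint (a single vertex counts as a trivial path). For vertex sets $U,V$, a $U$--$V$ path is a path $v_0e_1\cdots e_\ell v_\ell$ with $v_0\in U$, $v_\ell\in V$, and $v_i\notin U\cup V$ for $0<i<\ell$. Paths are vertex-disjoint if every edge (and vertex) of one is disjoint from every edge (and vertex) of the other. -}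

module Defs where

open import Data.Nat using (ℕ; zero; suc; _<_; _≤_)
open import Data.Fin using (Fin; toℕ; inject₁; fromℕ) renaming (zero to fzero; suc to fsuc)
open import Data.Maybe using (Maybe; just; nothing)
open import Data.Vec using (Vec; lookup; map; _[_]≔_)
open import Data.Product using (Σ; _×_)
open import Data.Sum using (_⊎_)
open import Data.Empty using (⊥)
open import Data.List using (List)
open import Data.List.Membership.Propositional using (_∈_; _∉_)
open import Relation.Binary.PropositionalEquality using (_≡_; _≢_)

-- r-tuples over [q] ∪ {α}; Fin q encodes [q] (value k ↦ k+1), α is 'nothing'.
Tuple : ℕ → ℕ → Set
Tuple q r = Vec (Maybe (Fin q)) r

EdgeIx : ℕ → ℕ → Set
EdgeIx q r = Vec (Fin q) r

IsVertex : ∀ {q r} → Tuple q r → Set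
IsVertex {r = r} v = Σ (Fin r) λ j → (lookup v j ≡ nothing) × (∀ k → k ≢ j → lookup v k ≢ nothing)

-- vertex v lies in the edge of H_q^r indexed by e:
-- v is obtained from e by replacing exactly one entry by α
_∈ₑ_ : ∀ {q r} → Tuple q r → EdgeIx q r → Set
_∈ₑ_ {r = r} v e = Σ (Fin r) λ j → v ≡ (map just e) [ j ]≔ nothing

LastIs : ∀ {A : Set} {r} → Vec A r → A → Set
LastIs {r = r} v a = ∀ (j : Fin r) → suc (toℕ j) ≡ r → lookup v j ≡ a

InUr : ∀ {q r} → Tuple q r → Set
InUr v = IsVertex v × LastIs v nothing

InWiUr : ∀ {q r} → Fin q → Tuple q r → Set
InWiUr i v = IsVertex v × (LastIs v (just i) ⊎ LastIs v nothing)

EdgeInHi : ∀ {q r} → Fin q → EdgeIx q r → Set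
EdgeInHi i e = ∀ v → v ∈ₑ e → InWiUr i v

-- a path v_0 e_1 v_1 ... e_ℓ v_ℓ (ℓ = len; edge k is e_{k+1}, vert k is v_k)
record Path (q r : ℕ) : Set where
  field
    len  : ℕ
    vert : Fin (suc len) → Tuple q r
    edge : Fin len → EdgeIx q r
open Path public

IsPath : ∀ {q r} → Path q r → Set
IsPath P =
  (∀ (k : Fin (len P)) → (vert P (inject₁ k) ∈ₑ edge P k) × (vert P (fsuc k) ∈ₑ edge P k))
  × (∀ (j k : Fin (len P)) → suc (toℕ j) < toℕ k →
       ∀ x → x ∈ₑ edge P j → x ∈ₑ edge P k → ⊥)
  × (∀ (k : Fin (suc (len P))) → IsVertex (vert P k))

IsUVPath : ∀ {q r} → List (Tuple q r) → List (Tuple q r) → Path q r → Set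
IsUVPath U V P =
  IsPath P
  × (vert P fzero ∈ U)
  × (vert P (fromℕ (len P)) ∈ V)
  × (∀ (k : Fin (suc (len P))) → 0 < toℕ k → toℕ k < len P →
       (vert P k ∉ U) × (vert P k ∉ V))

PathInHi : ∀ {q r} → Fin q → Path q r → Set
PathInHi i P =
  (∀ k → InWiUr i (vert P k)) × (∀ k → EdgeInHi i (edge P k))

_∈P_ : ∀ {q r} → Tuple q r → Path q r → Set
x ∈P P = (Σ (Fin (suc (len P))) λ k → x ≡ vert P k)
       ⊎ (Σ (Fin (len P)) λ k → x ∈ₑ edge P k)

Disjoint : ∀ {q r} → Path q r → Path q r → Set
Disjoint P Q = ∀ x → x ∈P P → x ∈P Q → ⊥

-- A vertex (p , α) of U_r is determined by a word p ∈ [q]^(r-1), and the edges of H_i are the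
-- edges indexed by (p , i). Two such edges meet only if their words are at Hamming distance at
-- most one, and edges of different layers meet only in U_r. Hence a chordless path p₀, …, p_ℓ in
-- the Hamming graph on [q]^(r-1) lifts to a U_r-to-U_r path of H_i through the edges (p_k , i),
-- and lifts of point-disjoint paths to distinct layers are vertex-disjoint. So it suffices to link
-- s words of U to s words of V by disjoint walks of the Hamming graph and to shortcut each walk.
--
-- The Hamming graph on [q]^(n+1) is K_q □ [q]^n, and in K_q □ G, for G with a connected ordering,
-- any two equally large sets of at most q points can be linked by disjoint walks. Induct along
-- the ordering. In the fibre of the newest vertex h (a clique) a point that is both a source and
-- a target is linked to itself, and every other target of the fibre to a source of the fibre by
-- an edge (if targets outnumber sources, swap the roles). The remaining sources go one step down
-- to the fibre of a neighbour h′ of h and are linked there by induction; a source whose spot below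
-- is already a source first moves sideways to a fresh column. Such sources are matched first, and
-- then counting the at most q sources shows that enough fresh columns exist.

module Submission where

open import Data.Empty using (⊥; ⊥-elim)
open import Data.Fin using (Fin; toℕ; fromℕ; inject₁; inject≤) renaming (zero to fzero; suc to fsuc)
open import Data.Fin.Properties using (¬∀⟶∃¬; any?; all?; toℕ-injective; toℕ-fromℕ; fromℕ≢inject₁; inject≤-injective)
  renaming (_≟_ to _≟ᶠ_)
open import Data.List as List using (List; []; _∷_; length; map; filter; allFin; zip; drop; take; _++_; cartesianProductWith)
open import Data.List.Properties
  using (length-map; length-++; length-take; length-tabulate; length-filter; filter-none; map-++; map-∘; map-id; map-cong)
open import Data.List.Membership.Propositional using (_∈_; _∉_)
open import Data.List.Membership.Propositional.Properties
  using (∈-allFin; ∈-lookup; ∈-map⁺; ∈-map⁻; ∈-filter⁺; ∈-filter⁻; ∈-++⁺ˡ; ∈-++⁺ʳ; ∈-++⁻; ∈-cartesianProductWith⁺; ∈-cartesianProductWith⁻)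
import Data.List.Membership.DecPropositional as DecMembership
open import Data.List.Relation.Binary.Disjoint.Propositional using () renaming (Disjoint to Disjointᴸ)
import Data.List.Relation.Binary.Disjoint.Propositional.Properties as Disjointᴸₚ
open import Data.List.Relation.Binary.Subset.Propositional using (_⊆_)
open import Data.List.Relation.Unary.All as All using (All; []; _∷_)
open import Data.List.Relation.Unary.All.Properties as Allₚ using (All¬⇒¬Any)
open import Data.List.Relation.Unary.Any as Any using (here; there)
open import Data.List.Relation.Unary.AllPairs as AllPairs using (AllPairs; []; _∷_)
import Data.List.Relation.Unary.AllPairs.Properties as AllPairsₚ
open import Data.List.Relation.Unary.Unique.Propositional using (Unique)
open import Data.List.Relation.Unary.Unique.Propositional.Properties as Uniqueₚ using (allFin⁺)
open import Data.Maybe using (Maybe; just; nothing)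
open import Data.Maybe.Properties using (just-injective)
open import Data.Nat using (ℕ; zero; suc; _+_; _∸_; _≤_; _<_; z≤n; s≤s)
open import Data.Nat.Properties
  using (≤-antisym; ≤-trans; <⇒≤; <⇒≱; ≰⇒>; _≤?_; m≤n+m; m≤n⇒m⊓n≡m; +-suc; +-identityʳ; +-comm; +-monoʳ-≤; +-cancelʳ-≡;
         suc-injective; module ≤-Reasoning)
open import Data.Nat.Solver using (module +-*-Solver)
open import Data.Product using (Σ; ∃; _×_; _,_; proj₁; proj₂; uncurry)
open import Data.Product.Properties using (≡-dec)
open import Data.Sum using (_⊎_; inj₁; inj₂)
open import Data.Vec as Vec using (Vec; []; _∷_; lookup; _[_]≔_; _∷ʳ_; initLast; uncons)
open import Data.Vec.Properties as Vecₚ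
  using (∷-injective; lookup∘update; lookup∘update′; lookup-map; map-∷ʳ; ∷ʳ-injectiveˡ; ∷ʳ-injectiveʳ; tabulate∘lookup; tabulate-cong)
open import Function using (_∘_; _on_)
open import Relation.Nullary using (¬_; Dec; yes; no; ¬?)
open import Relation.Nullary.Decidable using (map′; _×-dec_; _⊎-dec_; _→-dec_)
open import Relation.Binary.Definitions using (Decidable; DecidableEquality)
open import Relation.Binary.PropositionalEquality using (_≡_; _≢_; refl; sym; trans; cong; cong₂; subst; module ≡-Reasoning)
open import Relation.Binary.Construct.Closure.ReflexiveTransitive using (Star; ε; _◅_; gmap; revApp; reverse)
open import Defs

open +-*-Solver using (solve; _:+_; _:=_)

module _ {A : Set} where

  ∈⇒∃-removal : ∀ {x : A} ys → x ∈ ys → ∃ λ zs → suc (length zs) ≡ length ys × (∀ {z} → z ≢ x → z ∈ ys → z ∈ zs)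
  ∈⇒∃-removal (y ∷ ys) (here refl) = ys , refl , λ { z≢x (here refl) → ⊥-elim (z≢x refl) ; _ (there z∈) → z∈ }
  ∈⇒∃-removal (y ∷ ys) (there x∈) with ∈⇒∃-removal ys x∈
  ... | zs , len , keep = y ∷ zs , cong suc len , λ { _ (here refl) → here refl ; z≢x (there z∈) → there (keep z≢x z∈) }

  length-mono-⊆ : ∀ {xs ys : List A} → Unique xs → xs ⊆ ys → length xs ≤ length ys
  length-mono-⊆ {[]} _ _ = z≤n
  length-mono-⊆ {x ∷ xs} {ys} (x∉xs ∷ xs!) xs⊆ys with ∈⇒∃-removal ys (xs⊆ys (here refl))
  ... | zs , len , keep = subst (suc (length xs) ≤_) len (s≤s (length-mono-⊆ xs! xs⊆zs))
    where
    xs⊆zs : xs ⊆ zs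
    xs⊆zs z∈xs = keep (λ { refl → All¬⇒¬Any x∉xs z∈xs }) (xs⊆ys (there z∈xs))

  ⊆-⊇⇒length-≡ : ∀ {xs ys : List A} → Unique xs → Unique ys → xs ⊆ ys → ys ⊆ xs → length xs ≡ length ys
  ⊆-⊇⇒length-≡ xs! ys! xs⊆ys ys⊆xs = ≤-antisym (length-mono-⊆ xs! xs⊆ys) (length-mono-⊆ ys! ys⊆xs)

  ∈-take⁻ : ∀ n {xs : List A} {x} → x ∈ take n xs → x ∈ xs
  ∈-take⁻ (suc n) {_ ∷ _} (here refl) = here refl
  ∈-take⁻ (suc n) {_ ∷ _} (there x∈) = there (∈-take⁻ n x∈)

  ∈-drop⁻ : ∀ n {xs : List A} {x} → x ∈ drop n xs → x ∈ xs
  ∈-drop⁻ zero x∈ = x∈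
  ∈-drop⁻ (suc n) {_ ∷ _} x∈ = there (∈-drop⁻ n x∈)

  drop-++ : ∀ n (xs ys : List A) → drop n (xs ++ ys) ≡ drop n xs ++ drop (n ∸ length xs) ys
  drop-++ zero [] ys = refl
  drop-++ zero (x ∷ xs) ys = refl
  drop-++ (suc n) [] ys = refl
  drop-++ (suc n) (x ∷ xs) ys = drop-++ n xs ys

  drop≡[]⊎length-drop : ∀ n (xs : List A) → drop n xs ≡ [] ⊎ length (drop n xs) + n ≡ length xs
  drop≡[]⊎length-drop zero xs = inj₂ (+-identityʳ _)
  drop≡[]⊎length-drop (suc n) [] = inj₁ refl
  drop≡[]⊎length-drop (suc n) (x ∷ xs) with drop≡[]⊎length-drop n xs
  ... | inj₁ empty = inj₁ empty
  ... | inj₂ len = inj₂ (trans (+-suc _ n) (cong suc len))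

  length-drop-length : ∀ (xs ys : List A) → length ys ≤ length xs → length (drop (length ys) xs) + length ys ≡ length xs
  length-drop-length xs [] _ = +-identityʳ _
  length-drop-length (_ ∷ xs) (_ ∷ ys) (s≤s le) = trans (+-suc _ _) (cong suc (length-drop-length xs ys le))

  lookup-AllPairs : ∀ {R : A → A → Set} → (∀ {x y} → R x y → R y x) → ∀ {xs} → AllPairs R xs →
                    ∀ i j → i ≢ j → R (List.lookup xs i) (List.lookup xs j)
  lookup-AllPairs R-sym {_ ∷ _} (_ ∷ _) fzero fzero i≢j = ⊥-elim (i≢j refl)
  lookup-AllPairs R-sym {_ ∷ xs} (Rx ∷ _) fzero (fsuc j) _ = All.lookup Rx (∈-lookup j)
  lookup-AllPairs R-sym {_ ∷ xs} (Rx ∷ _) (fsuc i) fzero _ = R-sym (All.lookup Rx (∈-lookup i))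
  lookup-AllPairs R-sym (_ ∷ Rxs) (fsuc i) (fsuc j) i≢j = lookup-AllPairs R-sym Rxs i j (λ i≡j → i≢j (cong fsuc i≡j))

  AllPairs-All : ∀ {P : A → Set} {R : A → A → Set} {xs} → All P xs → AllPairs R xs → AllPairs (λ x y → P x × P y × R x y) xs
  AllPairs-All [] [] = []
  AllPairs-All (px ∷ pxs) (rx ∷ rxs) = All.zipWith (λ (py , r) → px , py , r) (pxs , rx) ∷ AllPairs-All pxs rxs

module _ {A B : Set} where

  Unique-map⇒injective : ∀ (f : A → B) {xs} → Unique (map f xs) → ∀ {a b} → a ∈ xs → b ∈ xs → f a ≡ f b → a ≡ b
  Unique-map⇒injective f _ (here refl) (here refl) _ = refl
  Unique-map⇒injective f {_ ∷ xs} (fa∉ ∷ _) (here refl) (there b∈) fa≡fb =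
    ⊥-elim (All¬⇒¬Any fa∉ (subst (_∈ map f xs) (sym fa≡fb) (∈-map⁺ f b∈)))
  Unique-map⇒injective f {_ ∷ xs} (fb∉ ∷ _) (there a∈) (here refl) fa≡fb =
    ⊥-elim (All¬⇒¬Any fb∉ (subst (_∈ map f xs) fa≡fb (∈-map⁺ f a∈)))
  Unique-map⇒injective f (_ ∷ fxs!) (there a∈) (there b∈) fa≡fb = Unique-map⇒injective f fxs! a∈ b∈ fa≡fb

  ∈-zip⁻ : ∀ {as : List A} {bs : List B} {a b} → (a , b) ∈ zip as bs → a ∈ as × b ∈ bs
  ∈-zip⁻ {_ ∷ _} {_ ∷ _} (here refl) = here refl , here refl
  ∈-zip⁻ {_ ∷ as} {_ ∷ bs} (there ab∈) with ∈-zip⁻ {as = as} {bs = bs} ab∈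
  ... | a∈ , b∈ = there a∈ , there b∈

  length-zip : ∀ (as : List A) (bs : List B) → length bs ≤ length as → length (zip as bs) ≡ length bs
  length-zip [] [] _ = refl
  length-zip (_ ∷ _) [] _ = refl
  length-zip (_ ∷ as) (_ ∷ bs) (s≤s le) = cong suc (length-zip as bs le)

  map-proj₁-zip : ∀ (as : List A) (bs : List B) → length as ≡ length bs → map proj₁ (zip as bs) ≡ as
  map-proj₁-zip [] _ _ = refl
  map-proj₁-zip (a ∷ as) (_ ∷ bs) len = cong (a ∷_) (map-proj₁-zip as bs (suc-injective len))

  map-proj₂-zip : ∀ (as : List A) (bs : List B) → length as ≡ length bs → map proj₂ (zip as bs) ≡ bs
  map-proj₂-zip [] [] _ = refl
  map-proj₂-zip (_ ∷ as) (b ∷ bs) len = cong (b ∷_) (map-proj₂-zip as bs (suc-injective len))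

module _ {A : Set} where

  Apart : A × A → A × A → Set
  Apart (a , b) (c , d) = a ≢ c × b ≢ d × a ≢ d × b ≢ c

  zip-∉-drop : ∀ {as bs : List A} → Unique as → ∀ {a b} → (a , b) ∈ zip as bs → a ∉ drop (length bs) as
  zip-∉-drop {_ ∷ as} {_ ∷ bs} (a∉ ∷ _) (here refl) a∈ = All¬⇒¬Any a∉ (∈-drop⁻ (length bs) a∈)
  zip-∉-drop {_ ∷ as} {_ ∷ bs} (_ ∷ as!) (there ab∈) = zip-∉-drop as! ab∈

  zip-Apart : ∀ {as bs : List A} → Unique as → Unique bs → Disjointᴸ as bs → AllPairs Apart (zip as bs)
  zip-Apart {[]} _ _ _ = []
  zip-Apart {_ ∷ _} {[]} _ _ _ = []
  zip-Apart {a ∷ as} {b ∷ bs} (a∉ ∷ as!) (b∉ ∷ bs!) as∩bs =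
    All.tabulate apart ∷ zip-Apart as! bs! (λ (x∈ , y∈) → as∩bs (there x∈ , there y∈))
    where
    apart : ∀ {cd} → cd ∈ zip as bs → Apart (a , b) cd
    apart {c , d} cd∈ with ∈-zip⁻ {as = as} {bs = bs} cd∈
    ... | c∈ , d∈ = (λ { refl → All¬⇒¬Any a∉ c∈ }) , (λ { refl → All¬⇒¬Any b∉ d∈ })
                  , (λ { refl → as∩bs (here refl , there d∈) }) , (λ { refl → as∩bs (there c∈ , here refl) })

length<⇒∃∉ : ∀ {q} (xs : List (Fin q)) → length xs < q → ∃ λ y → y ∉ xs
length<⇒∃∉ {q} xs short with all? (λ y → Any.any? (y ≟ᶠ_) xs)
... | yes all∈ = ⊥-elim (<⇒≱ short (subst (_≤ length xs) (length-tabulate _) (length-mono-⊆ (allFin⁺ q) (λ {y} _ → all∈ y))))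
... | no ¬all∈ = ¬∀⟶∃¬ q _ (λ y → Any.any? (y ≟ᶠ_) xs) ¬all∈

fresh : ∀ {q} (avoid : List (Fin q)) n → n + length avoid ≤ q →
        ∃ λ ys → length ys ≡ n × Unique ys × All (_∉ avoid) ys
fresh avoid zero _ = [] , refl , [] , []
fresh {q} avoid (suc n) room with length<⇒∃∉ avoid (≤-trans (s≤s (m≤n+m _ n)) room)
... | y , y∉ with fresh (y ∷ avoid) n (subst (_≤ q) (sym (+-suc n _)) room)
... | ys , len , ys! , ys∉ =
  y ∷ ys , cong suc len , All.map (λ z∉ y≡z → z∉ (here (sym y≡z))) ys∉ ∷ ys! , y∉ ∷ All.map (λ z∉ z∈ → z∉ (there z∈)) ys∉

-- Walks and chordless paths

module _ {A : Set} {R : A → A → Set} where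

  vertices : ∀ {a b} → Star R a b → List A
  vertices {a} ε = a ∷ []
  vertices {a} (_ ◅ w) = a ∷ vertices w

  source∈vertices : ∀ {a b} (w : Star R a b) → a ∈ vertices w
  source∈vertices ε = here refl
  source∈vertices (_ ◅ _) = here refl

  module _ (R-sym : ∀ {x y} → R x y → R y x) where

    ∈-vertices-revApp⁻ : ∀ {a b c x} (w : Star R a b) (acc : Star R a c) →
                         x ∈ vertices (revApp R-sym w acc) → x ∈ vertices w ⊎ x ∈ vertices acc
    ∈-vertices-revApp⁻ ε acc x∈ = inj₂ x∈
    ∈-vertices-revApp⁻ (r ◅ w) acc x∈ with ∈-vertices-revApp⁻ w (R-sym r ◅ acc) x∈
    ... | inj₁ x∈w = inj₁ (there x∈w)
    ... | inj₂ (here refl) = inj₁ (there (source∈vertices w))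
    ... | inj₂ (there x∈acc) = inj₂ x∈acc

    vertices-reverse⊆ : ∀ {a b} (w : Star R a b) → vertices (reverse R-sym w) ⊆ vertices w
    vertices-reverse⊆ w x∈ with ∈-vertices-revApp⁻ w ε x∈
    ... | inj₁ x∈w = x∈w
    ... | inj₂ (here refl) = source∈vertices w

module _ {A B : Set} {R : A → A → Set} {S : B → B → Set} where

  vertices-gmap : ∀ (f : A → B) (g : ∀ {x y} → R x y → S (f x) (f y)) {a b} (w : Star R a b) →
                  vertices (gmap {U = S} f g w) ≡ map f (vertices w)
  vertices-gmap f g ε = refl
  vertices-gmap f g (r ◅ w) = cong (f _ ∷_) (vertices-gmap f g w)

module _ {A : Set} (R : A → A → Set) where

  data ConnectedOrder : List A → Set where
    [] : ConnectedOrder []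
    grow : ∀ {a as} → a ∉ as → as ≡ [] ⊎ (∃ λ b → b ∈ as × R a b) → ConnectedOrder as → ConnectedOrder (a ∷ as)

  data Chordless : A → List A → A → Set where
    [] : ∀ {a} → Chordless a [] a
    _∷_ : ∀ {a b xs c} → R a b × All (¬_ ∘ R a) xs → Chordless b xs c → Chordless a (b ∷ xs) c

module _ {A : Set} {R : A → A → Set} (R? : Decidable R) where

  record LastNeighbour (a b : A) (bs : List A) (c : A) : Set where
    field
      head : A
      tail : List A
      adjacent : R a head
      nonadjacent : All (¬_ ∘ R a) tail
      path : Chordless R head tail c
      suffix : head ∷ tail ⊆ b ∷ bs

  lastNeighbour : ∀ a {b bs c} → Chordless R b bs c → All (¬_ ∘ R a) (b ∷ bs) ⊎ LastNeighbour a b bs c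
  lastNeighbour a {b} [] with R? a b
  ... | yes r = inj₂ (record { head = b ; tail = [] ; adjacent = r ; nonadjacent = [] ; path = [] ; suffix = λ x∈ → x∈ })
  ... | no ¬r = inj₁ (¬r ∷ [])
  lastNeighbour a {b} (step ∷ p) with lastNeighbour a p
  ... | inj₂ n = inj₂ (record { LastNeighbour n ; suffix = there ∘ LastNeighbour.suffix n })
  ... | inj₁ none with R? a b
  ...   | yes r = inj₂ (record { head = b ; tail = _ ; adjacent = r ; nonadjacent = none ; path = step ∷ p ; suffix = λ x∈ → x∈ })
  ...   | no ¬r = inj₁ (¬r ∷ none)

  chordless-subpath : ∀ {a c} (w : Star R a c) → ∃ λ xs → Chordless R a xs c × a ∷ xs ⊆ vertices w
  chordless-subpath ε = [] , [] , λ x∈ → x∈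
  chordless-subpath {a} (r ◅ w) with chordless-subpath w
  ... | _ , p , p⊆w with lastNeighbour a p
  ...   | inj₁ (¬r ∷ _) = ⊥-elim (¬r r)
  ...   | inj₂ n = head ∷ tail , (adjacent , nonadjacent) ∷ path
                 , λ { (here refl) → here refl ; (there x∈) → there (p⊆w (suffix x∈)) }
    where open LastNeighbour n

module _ {A : Set} {R : A → A → Set} where

  Chordless-nonadjacent : ∀ {a xs c} → Chordless R a xs c → ∀ j k → suc (toℕ j) < toℕ k →
                          ¬ R (List.lookup (a ∷ xs) j) (List.lookup (a ∷ xs) k)
  Chordless-nonadjacent (_ ∷ _) fzero (fsuc fzero) (s≤s ())
  Chordless-nonadjacent ((_ , nonadjacent) ∷ _) fzero (fsuc (fsuc k)) _ = All.lookup nonadjacent (∈-lookup k)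
  Chordless-nonadjacent (_ ∷ p) (fsuc j) (fsuc k) (s≤s j<k) = Chordless-nonadjacent p j k j<k

-- Disjoint linkages in the product of a complete graph with a connected graph

module ProductLinkage (q : ℕ) {H : Set} (_≟_ : DecidableEquality H) (R : H → H → Set) (R-sym : ∀ {h k} → R h k → R k h) where

  open DecMembership (≡-dec (_≟ᶠ_ {n = q}) _≟_) using (_∈?_)

  Point : Set
  Point = Fin q × H

  data _~_ : Point → Point → Set where
    fibre : ∀ {x y h} → (x , h) ~ (y , h)
    column : ∀ {x h k} → R h k → (x , h) ~ (x , k)

  ~-sym : ∀ {a b} → a ~ b → b ~ a
  ~-sym fibre = fibre
  ~-sym (column r) = column (R-sym r)

  Walk : Point → Point → Set
  Walk = Star _~_

  Over : List H → Point → Set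
  Over hs = (_∈ hs) ∘ proj₂

  record Link (U V : List Point) : Set where
    constructor link
    field
      {source target} : Point
      source∈ : source ∈ U
      target∈ : target ∈ V
      walk : Walk source target
  open Link public

  points : ∀ {U V} → Link U V → List Point
  points = vertices ∘ walk

  Linkage : List H → List Point → List Point → Set
  Linkage hs U V = ∃ λ (ls : List (Link U V)) →
    length ls ≡ length U × All (All (Over hs) ∘ points) ls × AllPairs (Disjointᴸ on points) ls

  Linked : List H → Set
  Linked hs = ∀ U V → Unique U → Unique V → All (Over hs) U → All (Over hs) V →
              length U ≡ length V → length U ≤ q → Linkage hs U V

  flip-link : ∀ {U V} → Link V U → Link U V
  flip-link (link s∈ t∈ w) = link t∈ s∈ (reverse ~-sym w)

  points-flip-link : ∀ {U V} (l : Link V U) → points (flip-link l) ⊆ points l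
  points-flip-link l = vertices-reverse⊆ ~-sym (walk l)

  linkage-flip : ∀ {hs U V} → length U ≡ length V → Linkage hs V U → Linkage hs U V
  linkage-flip {hs} |U|≡|V| (ls , len , over , disjoint) =
      map flip-link ls
    , trans (length-map flip-link ls) (trans len (sym |U|≡|V|))
    , Allₚ.map⁺ (All.map (λ {l} over-l → All.tabulate (All.lookup over-l ∘ points-flip-link l)) over)
    , AllPairsₚ.map⁺ (AllPairs.map (λ {l} {l′} l∩l′ {x} (x∈ , x∈′) → l∩l′ (points-flip-link l x∈ , points-flip-link l′ x∈′))
                                   disjoint)

  module TopFibre (h : H) (hs : List H) (h∉hs : h ∉ hs) (U V : List Point) (U! : Unique U) (V! : Unique V)
                  (U-over : All (Over (h ∷ hs)) U) (V-over : All (Over (h ∷ hs)) V)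
                  (|U|≡|V| : length U ≡ length V) (|U|≤q : length U ≤ q) where

    top : Fin q → Point
    top x = x , h

    top-injective : ∀ {x y} → top x ≡ top y → x ≡ y
    top-injective refl = refl

    InU InV Occupied : Fin q → Set
    InU x = top x ∈ U
    InV x = top x ∈ V
    Occupied x = InU x ⊎ InV x

    InU? : ∀ x → Dec (InU x)
    InU? x = top x ∈? U
    InV? : ∀ x → Dec (InV x)
    InV? x = top x ∈? V

    shared onlyU onlyV : List (Fin q)
    shared = filter (λ x → InU? x ×-dec InV? x) (allFin q)
    onlyU = filter (λ x → InU? x ×-dec ¬? (InV? x)) (allFin q)
    onlyV = filter (λ x → InV? x ×-dec ¬? (InU? x)) (allFin q)

    shared! : Unique shared
    shared! = Uniqueₚ.filter⁺ _ (allFin⁺ q)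
    onlyU! : Unique onlyU
    onlyU! = Uniqueₚ.filter⁺ _ (allFin⁺ q)
    onlyV! : Unique onlyV
    onlyV! = Uniqueₚ.filter⁺ _ (allFin⁺ q)

    ∈-shared⁻ : ∀ {x} → x ∈ shared → InU x × InV x
    ∈-shared⁻ = proj₂ ∘ ∈-filter⁻ _ {xs = allFin q}
    ∈-onlyU⁻ : ∀ {x} → x ∈ onlyU → InU x × ¬ InV x
    ∈-onlyU⁻ = proj₂ ∘ ∈-filter⁻ _ {xs = allFin q}
    ∈-onlyV⁻ : ∀ {x} → x ∈ onlyV → InV x × ¬ InU x
    ∈-onlyV⁻ = proj₂ ∘ ∈-filter⁻ _ {xs = allFin q}

    ∈-shared⁺ : ∀ {x} → InU x → InV x → x ∈ shared
    ∈-shared⁺ u v = ∈-filter⁺ _ (∈-allFin _) (u , v)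
    ∈-onlyU⁺ : ∀ {x} → InU x → ¬ InV x → x ∈ onlyU
    ∈-onlyU⁺ u ¬v = ∈-filter⁺ _ (∈-allFin _) (u , ¬v)
    ∈-onlyV⁺ : ∀ {x} → InV x → ¬ InU x → x ∈ onlyV
    ∈-onlyV⁺ v ¬u = ∈-filter⁺ _ (∈-allFin _) (v , ¬u)

    shared∩onlyU : Disjointᴸ shared onlyU
    shared∩onlyU (x∈ , x∈′) = proj₂ (∈-onlyU⁻ x∈′) (proj₂ (∈-shared⁻ x∈))
    shared∩onlyV : Disjointᴸ shared onlyV
    shared∩onlyV (x∈ , x∈′) = proj₂ (∈-onlyV⁻ x∈′) (proj₁ (∈-shared⁻ x∈))
    onlyU∩onlyV : Disjointᴸ onlyU onlyV
    onlyU∩onlyV (x∈ , x∈′) = proj₂ (∈-onlyV⁻ x∈′) (proj₁ (∈-onlyU⁻ x∈))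

    onlyU-occupied : ∀ {x} → x ∈ onlyU → Occupied x
    onlyU-occupied = inj₁ ∘ proj₁ ∘ ∈-onlyU⁻

    off-top? : ∀ (p : Point) → Dec (¬ proj₂ p ≡ h)
    off-top? p = ¬? (proj₂ p ≟ h)

    lower : List Point → List Point
    lower = filter off-top?

    length-lower : ∀ W → Unique W → ∀ L → Unique L → (∀ {x} → top x ∈ W → x ∈ L) → (∀ {x} → x ∈ L → top x ∈ W) →
                   length W ≡ length (lower W) + length L
    length-lower W W! L L! W⊆L L⊆W = begin
      length W                           ≡⟨ ⊆-⊇⇒length-≡ W! split! W⊆split split⊆W ⟩
      length (lower W ++ map top L)      ≡⟨ length-++ (lower W) ⟩
      length (lower W) + length (map top L) ≡⟨ cong (length (lower W) +_) (length-map top L) ⟩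
      length (lower W) + length L        ∎
      where
      open ≡-Reasoning
      split! : Unique (lower W ++ map top L)
      split! = Uniqueₚ.++⁺ (Uniqueₚ.filter⁺ _ W!) (Uniqueₚ.map⁺ top-injective L!) λ (p∈ , p∈′) →
        case-top (∈-filter⁻ _ {xs = W} p∈) (∈-map⁻ top p∈′)
        where
        case-top : ∀ {p} → p ∈ W × ¬ proj₂ p ≡ h → ∃ (λ x → x ∈ L × p ≡ top x) → _
        case-top (_ , p∉top) (_ , _ , refl) = p∉top refl
      W⊆split : W ⊆ lower W ++ map top L
      W⊆split {x , k} p∈ with k ≟ h
      ... | yes refl = ∈-++⁺ʳ (lower W) (∈-map⁺ top (W⊆L p∈))
      ... | no k≢h = ∈-++⁺ˡ (∈-filter⁺ _ p∈ k≢h)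
      split⊆W : lower W ++ map top L ⊆ W
      split⊆W p∈ with ∈-++⁻ (lower W) p∈
      ... | inj₁ p∈lower = proj₁ (∈-filter⁻ _ {xs = W} p∈lower)
      ... | inj₂ p∈top with ∈-map⁻ top p∈top
      ...   | _ , x∈ , refl = L⊆W x∈

    length-U : length U ≡ length (lower U) + (length shared + length onlyU)
    length-U = trans (length-lower U U! (shared ++ onlyU) (Uniqueₚ.++⁺ shared! onlyU! shared∩onlyU) split join)
                     (cong (length (lower U) +_) (length-++ shared))
      where
      split : ∀ {x} → InU x → x ∈ shared ++ onlyU
      split {x} u with InV? x
      ... | yes v = ∈-++⁺ˡ (∈-shared⁺ u v)
      ... | no ¬v = ∈-++⁺ʳ shared (∈-onlyU⁺ u ¬v)
      join : ∀ {x} → x ∈ shared ++ onlyU → InU x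
      join x∈ with ∈-++⁻ shared x∈
      ... | inj₁ x∈shared = proj₁ (∈-shared⁻ x∈shared)
      ... | inj₂ x∈onlyU = proj₁ (∈-onlyU⁻ x∈onlyU)

    length-V : length V ≡ length (lower V) + (length shared + length onlyV)
    length-V = trans (length-lower V V! (shared ++ onlyV) (Uniqueₚ.++⁺ shared! onlyV! shared∩onlyV) split join)
                     (cong (length (lower V) +_) (length-++ shared))
      where
      split : ∀ {x} → InV x → x ∈ shared ++ onlyV
      split {x} v with InU? x
      ... | yes u = ∈-++⁺ˡ (∈-shared⁺ u v)
      ... | no ¬u = ∈-++⁺ʳ shared (∈-onlyV⁺ v ¬u)
      join : ∀ {x} → x ∈ shared ++ onlyV → InV x
      join x∈ with ∈-++⁻ shared x∈
      ... | inj₁ x∈shared = proj₂ (∈-shared⁻ x∈shared)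
      ... | inj₂ x∈onlyV = proj₁ (∈-onlyV⁻ x∈onlyV)

    Free : List (Fin q) → Point → Set
    Free leftover p = Over hs p ⊎ (proj₂ p ≡ h × (proj₁ p ∈ leftover ⊎ ¬ Occupied (proj₁ p)))

    ¬Free-top : ∀ {leftover x} → x ∉ leftover → Occupied x → ¬ Free leftover (top x)
    ¬Free-top _ _ (inj₁ h∈hs) = h∉hs h∈hs
    ¬Free-top x∉ _ (inj₂ (_ , inj₁ x∈)) = x∉ x∈
    ¬Free-top _ occupied (inj₂ (_ , inj₂ ¬occupied)) = ¬occupied occupied

    Descent : List (Fin q) → Set
    Descent leftover = ∃ λ (ls : List (Link U V)) →
      length ls ≡ length (lower V) × All (All (Free leftover) ∘ points) ls × AllPairs (Disjointᴸ on points) ls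

    TopPair : Fin q × Fin q → Set
    TopPair (a , b) = InU a × InV b

    topLinks : ∀ ps → All TopPair ps → List (Link U V)
    topLinks [] [] = []
    topLinks ((a , b) ∷ ps) ((a∈ , b∈) ∷ oks) = link a∈ b∈ (fibre ◅ ε) ∷ topLinks ps oks

    length-topLinks : ∀ ps oks → length (topLinks ps oks) ≡ length ps
    length-topLinks [] [] = refl
    length-topLinks (_ ∷ ps) (_ ∷ oks) = cong suc (length-topLinks ps oks)

    topLinks-over : ∀ ps oks → All (All (Over (h ∷ hs)) ∘ points) (topLinks ps oks)
    topLinks-over [] [] = []
    topLinks-over (_ ∷ ps) (_ ∷ oks) = (here refl ∷ here refl ∷ []) ∷ topLinks-over ps oks

    topLinks-disjoint : ∀ ps oks → AllPairs Apart ps → AllPairs (Disjointᴸ on points) (topLinks ps oks)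
    topLinks-disjoint [] [] [] = []
    topLinks-disjoint ((a , b) ∷ ps) (_ ∷ oks) (apart ∷ ps-apart) = head-disjoint ps oks apart ∷ topLinks-disjoint ps oks ps-apart
      where
      head-disjoint : ∀ ps oks → All (Apart (a , b)) ps → All (λ l → Disjointᴸ (top a ∷ top b ∷ []) (points l)) (topLinks ps oks)
      head-disjoint [] [] [] = []
      head-disjoint (_ ∷ ps) (_ ∷ oks) ((a≢c , b≢d , a≢d , b≢c) ∷ apart) = two-points-apart ∷ head-disjoint ps oks apart
        where
        two-points-apart : Disjointᴸ (top a ∷ top b ∷ []) _
        two-points-apart (here refl , here eq) = a≢c (top-injective eq)
        two-points-apart (here refl , there (here eq)) = a≢d (top-injective eq)
        two-points-apart (there (here refl) , here eq) = b≢c (top-injective eq)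
        two-points-apart (there (here refl) , there (here eq)) = b≢d (top-injective eq)

    topLinks-avoid : ∀ {leftover} ps oks → All (λ (a , b) → a ∉ leftover × b ∉ leftover) ps →
                     ∀ {ls : List (Link U V)} → All (All (Free leftover) ∘ points) ls →
                     All (λ t → All ((Disjointᴸ on points) t) ls) (topLinks ps oks)
    topLinks-avoid [] [] [] _ = []
    topLinks-avoid {leftover} ((a , b) ∷ ps) ((a∈ , b∈) ∷ oks) ((a∉ , b∉) ∷ reserved) free =
      All.map avoid free ∷ topLinks-avoid ps oks reserved free
      where
      avoid : ∀ {xs} → All (Free leftover) xs → Disjointᴸ (top a ∷ top b ∷ []) xs
      avoid free (here refl , x∈) = ¬Free-top a∉ (inj₁ a∈) (All.lookup free x∈)
      avoid free (there (here refl) , x∈) = ¬Free-top b∉ (inj₂ b∈) (All.lookup free x∈)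

    record TopMatching : Set where
      field
        pairs : List (Fin q × Fin q)
        leftover : List (Fin q)
        pairs⊆ : ∀ {a b} → (a , b) ∈ pairs → a ∈ onlyU × b ∈ onlyV
        pairs∉leftover : ∀ {a b} → (a , b) ∈ pairs → a ∉ leftover
        leftover⊆onlyU : leftover ⊆ onlyU
        pairs-apart : AllPairs Apart pairs
        length-pairs : length pairs ≡ length onlyV

    matching : ∀ order → Unique order → order ⊆ onlyU → length onlyV ≤ length order → TopMatching
    matching order order! order⊆ room = record
      { pairs = zip order onlyV
      ; leftover = drop (length onlyV) order
      ; pairs⊆ = λ ab∈ → let a∈ , b∈ = ∈-zip⁻ ab∈ in order⊆ a∈ , b∈
      ; pairs∉leftover = zip-∉-drop order!
      ; leftover⊆onlyU = order⊆ ∘ ∈-drop⁻ (length onlyV)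
      ; pairs-apart = zip-Apart order! onlyV! (λ (x∈ , x∈′) → onlyU∩onlyV (order⊆ x∈ , x∈′))
      ; length-pairs = length-zip order onlyV room
      }

    diagonal : Fin q → Fin q × Fin q
    diagonal x = x , x

    module _ (m : TopMatching) where
      open TopMatching m

      topPairs : List (Fin q × Fin q)
      topPairs = map diagonal shared ++ pairs

      topPairs-ok : All TopPair topPairs
      topPairs-ok = Allₚ.++⁺ (Allₚ.map⁺ (All.tabulate ∈-shared⁻))
                             (All.tabulate (λ ab∈ → let a∈ , b∈ = pairs⊆ ab∈ in proj₁ (∈-onlyU⁻ a∈) , proj₁ (∈-onlyV⁻ b∈)))

      topPairs-reserved : All (λ (a , b) → a ∉ leftover × b ∉ leftover) topPairs
      topPairs-reserved =
        Allₚ.++⁺ (Allₚ.map⁺ (All.tabulate λ x∈ → let x∉ = λ x∈lo → shared∩onlyU (x∈ , leftover⊆onlyU x∈lo) in x∉ , x∉))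
                 (All.tabulate (λ ab∈ → pairs∉leftover ab∈ , λ b∈lo → onlyU∩onlyV (leftover⊆onlyU b∈lo , proj₂ (pairs⊆ ab∈))))

      topPairs-apart : AllPairs Apart topPairs
      topPairs-apart = AllPairsₚ.++⁺ (AllPairsₚ.map⁺ (AllPairs.map (λ x≢y → x≢y , x≢y , x≢y , x≢y) shared!)) pairs-apart
        (Allₚ.map⁺ (All.tabulate λ x∈ → All.tabulate λ ab∈ → let a∈ , b∈ = pairs⊆ ab∈ in
          (λ { refl → shared∩onlyU (x∈ , a∈) }) , (λ { refl → shared∩onlyV (x∈ , b∈) }) ,
          (λ { refl → shared∩onlyV (x∈ , b∈) }) , (λ { refl → shared∩onlyU (x∈ , a∈) })))

      length-topPairs : length topPairs ≡ length shared + length onlyV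
      length-topPairs = trans (length-++ (map diagonal shared)) (cong₂ _+_ (length-map diagonal shared) length-pairs)

      Free⇒Over : ∀ {p} → Free leftover p → Over (h ∷ hs) p
      Free⇒Over (inj₁ k∈hs) = there k∈hs
      Free⇒Over (inj₂ (refl , _)) = here refl

      assemble : Descent leftover → Linkage (h ∷ hs) U V
      assemble (dls , length-dls , dls-free , dls-disjoint) =
          topLinks topPairs topPairs-ok ++ dls , length-links
        , Allₚ.++⁺ (topLinks-over topPairs topPairs-ok) (All.map (All.map Free⇒Over) dls-free)
        , AllPairsₚ.++⁺ (topLinks-disjoint topPairs topPairs-ok topPairs-apart) dls-disjoint
                        (topLinks-avoid topPairs topPairs-ok topPairs-reserved dls-free)
        where
        length-links : length (topLinks topPairs topPairs-ok ++ dls) ≡ length U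
        length-links = begin
          length (topLinks topPairs topPairs-ok ++ dls)       ≡⟨ length-++ (topLinks topPairs topPairs-ok) ⟩
          length (topLinks topPairs topPairs-ok) + length dls ≡⟨ cong₂ _+_ (length-topLinks topPairs topPairs-ok) length-dls ⟩
          length topPairs + length (lower V)                  ≡⟨ cong (_+ length (lower V)) length-topPairs ⟩
          (length shared + length onlyV) + length (lower V)   ≡⟨ +-comm _ (length (lower V)) ⟩
          length (lower V) + (length shared + length onlyV)   ≡⟨ sym length-V ⟩
          length V                                            ≡⟨ sym |U|≡|V| ⟩
          length U                                            ∎
          where open ≡-Reasoning

    linkage-base : hs ≡ [] → length onlyV ≤ length onlyU → Linkage (h ∷ hs) U V
    linkage-base refl room = assemble (matching onlyU onlyU! (λ x∈ → x∈) room) ([] , sym (cong length lower-V≡[]) , [] , [])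
      where
      lower-V≡[] : lower V ≡ []
      lower-V≡[] = filter-none _ (All.map (λ { (here k≡h) k≢h → k≢h k≡h }) V-over)

    module Descend (h′ : H) (h′∈hs : h′ ∈ hs) (r : R h h′) (IH : Linked hs) (room : length onlyV ≤ length onlyU) where

      h′≢h : h′ ≢ h
      h′≢h refl = h∉hs h′∈hs

      bottom : Fin q → Point
      bottom y = y , h′

      bottom-injective : ∀ {x y} → bottom x ≡ bottom y → x ≡ y
      bottom-injective refl = refl

      Blocked : Fin q → Set
      Blocked y = bottom y ∈ U

      Blocked? : ∀ y → Dec (Blocked y)
      Blocked? y = bottom y ∈? U

      -- Blocked sources are matched first, so that only |blocked| ∸ |onlyV| of them are left
      -- over; those are the ones that need a fresh column.
      blocked unblocked order : List (Fin q)
      blocked = filter Blocked? onlyU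
      unblocked = filter (¬? ∘ Blocked?) onlyU
      order = blocked ++ unblocked

      ∈-blocked⁻ : ∀ {x} → x ∈ blocked → x ∈ onlyU × Blocked x
      ∈-blocked⁻ = ∈-filter⁻ Blocked? {xs = onlyU}
      ∈-unblocked⁻ : ∀ {x} → x ∈ unblocked → x ∈ onlyU × ¬ Blocked x
      ∈-unblocked⁻ = ∈-filter⁻ (¬? ∘ Blocked?) {xs = onlyU}

      order! : Unique order
      order! = Uniqueₚ.++⁺ (Uniqueₚ.filter⁺ _ onlyU!) (Uniqueₚ.filter⁺ _ onlyU!)
                 λ (x∈ , x∈′) → proj₂ (∈-unblocked⁻ x∈′) (proj₂ (∈-blocked⁻ x∈))

      order⊆onlyU : order ⊆ onlyU
      order⊆onlyU x∈ with ∈-++⁻ blocked x∈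
      ... | inj₁ x∈b = proj₁ (∈-blocked⁻ x∈b)
      ... | inj₂ x∈u = proj₁ (∈-unblocked⁻ x∈u)

      onlyU⊆order : onlyU ⊆ order
      onlyU⊆order {x} x∈ with Blocked? x
      ... | yes b = ∈-++⁺ˡ (∈-filter⁺ _ x∈ b)
      ... | no ¬b = ∈-++⁺ʳ blocked (∈-filter⁺ _ x∈ ¬b)

      length-order : length order ≡ length onlyU
      length-order = ⊆-⊇⇒length-≡ order! onlyU! order⊆onlyU onlyU⊆order

      topMatching : TopMatching
      topMatching = matching order order! order⊆onlyU (subst (length onlyV ≤_) (sym length-order) room)
      open TopMatching topMatching

      stuck clear : List (Fin q)
      stuck = drop (length onlyV) blocked
      clear = drop (length onlyV ∸ length blocked) unblocked

      leftover≡ : leftover ≡ stuck ++ clear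
      leftover≡ = drop-++ (length onlyV) blocked unblocked

      clear⊆unblocked : clear ⊆ unblocked
      clear⊆unblocked = ∈-drop⁻ (length onlyV ∸ length blocked)

      Occupied? : ∀ x → Dec (Occupied x)
      Occupied? x = InU? x ⊎-dec InV? x

      avoid blockedFree : List (Fin q)
      avoid = filter (λ y → Occupied? y ⊎-dec Blocked? y) (allFin q)
      blockedFree = filter (λ y → ¬? (Occupied? y) ×-dec Blocked? y) (allFin q)

      length-avoid : length avoid ≤ length shared + (length onlyU + (length onlyV + length blockedFree))
      length-avoid = subst (length avoid ≤_) lengths (length-mono-⊆ (Uniqueₚ.filter⁺ _ (allFin⁺ q)) avoid⊆)
        where
        lengths : length (shared ++ onlyU ++ onlyV ++ blockedFree)
                ≡ length shared + (length onlyU + (length onlyV + length blockedFree))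
        lengths = trans (length-++ shared)
                        (cong (length shared +_) (trans (length-++ onlyU) (cong (length onlyU +_) (length-++ onlyV))))
        avoid⊆ : avoid ⊆ shared ++ onlyU ++ onlyV ++ blockedFree
        avoid⊆ {y} y∈ with InU? y | InV? y
        ... | yes u | yes v = ∈-++⁺ˡ (∈-shared⁺ u v)
        ... | yes u | no ¬v = ∈-++⁺ʳ shared (∈-++⁺ˡ (∈-onlyU⁺ u ¬v))
        ... | no ¬u | yes v = ∈-++⁺ʳ shared (∈-++⁺ʳ onlyU (∈-++⁺ˡ (∈-onlyV⁺ v ¬u)))
        ... | no ¬u | no ¬v with proj₂ (∈-filter⁻ _ {xs = allFin q} y∈)
        ...   | inj₁ (inj₁ u) = ⊥-elim (¬u u)
        ...   | inj₁ (inj₂ v) = ⊥-elim (¬v v)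
        ...   | inj₂ b = ∈-++⁺ʳ shared (∈-++⁺ʳ onlyU (∈-++⁺ʳ onlyV
                           (∈-filter⁺ _ (∈-allFin y) ((λ { (inj₁ u) → ¬u u ; (inj₂ v) → ¬v v }) , b))))

      length-sources : (length shared + length onlyU) + (length blockedFree + length blocked) ≤ length U
      length-sources = subst (_≤ length U) lengths (length-mono-⊆ sources! sources⊆U)
        where
        sources : List Point
        sources = map top (shared ++ onlyU) ++ map bottom (blockedFree ++ blocked)
        lengths : length sources ≡ (length shared + length onlyU) + (length blockedFree + length blocked)
        lengths = trans (length-++ (map top (shared ++ onlyU)))
                        (cong₂ _+_ (trans (length-map top (shared ++ onlyU)) (length-++ shared))
                                   (trans (length-map bottom (blockedFree ++ blocked)) (length-++ blockedFree)))
        sources! : Unique sources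
        sources! = Uniqueₚ.++⁺ (Uniqueₚ.map⁺ top-injective (Uniqueₚ.++⁺ shared! onlyU! shared∩onlyU))
                               (Uniqueₚ.map⁺ bottom-injective
                                  (Uniqueₚ.++⁺ (Uniqueₚ.filter⁺ _ (allFin⁺ q)) (Uniqueₚ.filter⁺ _ onlyU!) free∩blocked))
                               top∩bottom
          where
          free∩blocked : Disjointᴸ blockedFree blocked
          free∩blocked (x∈ , x∈′) = proj₁ (proj₂ (∈-filter⁻ _ {xs = allFin q} x∈)) (onlyU-occupied (proj₁ (∈-blocked⁻ x∈′)))
          top∩bottom : Disjointᴸ (map top (shared ++ onlyU)) (map bottom (blockedFree ++ blocked))
          top∩bottom (p∈ , p∈′) with ∈-map⁻ top p∈ | ∈-map⁻ bottom p∈′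
          ... | _ , _ , refl | _ , _ , eq = h′≢h (sym (cong proj₂ eq))
        sources⊆U : sources ⊆ U
        sources⊆U p∈ with ∈-++⁻ (map top (shared ++ onlyU)) p∈
        ... | inj₁ p∈top with ∈-map⁻ top p∈top
        ...   | x , x∈ , refl with ∈-++⁻ shared x∈
        ...     | inj₁ x∈s = proj₁ (∈-shared⁻ x∈s)
        ...     | inj₂ x∈u = proj₁ (∈-onlyU⁻ x∈u)
        sources⊆U p∈ | inj₂ p∈bottom with ∈-map⁻ bottom p∈bottom
        ...   | y , y∈ , refl with ∈-++⁻ blockedFree y∈
        ...     | inj₁ y∈f = proj₂ (proj₂ (∈-filter⁻ _ {xs = allFin q} y∈f))
        ...     | inj₂ y∈b = proj₂ (∈-blocked⁻ y∈b)

      room-for-columns : length stuck + length onlyV ≡ length blocked → length stuck + length avoid ≤ q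
      room-for-columns stuck+onlyV≡blocked = begin
        length stuck + length avoid
          ≤⟨ +-monoʳ-≤ (length stuck) length-avoid ⟩
        length stuck + (length shared + (length onlyU + (length onlyV + length blockedFree)))
          ≡⟨ rearrange (length stuck) (length shared) (length onlyU) (length onlyV) (length blockedFree) ⟩
        (length shared + length onlyU) + (length blockedFree + (length stuck + length onlyV))
          ≡⟨ cong (λ n → (length shared + length onlyU) + (length blockedFree + n)) stuck+onlyV≡blocked ⟩
        (length shared + length onlyU) + (length blockedFree + length blocked)
          ≤⟨ length-sources ⟩
        length U
          ≤⟨ |U|≤q ⟩
        q ∎
        where
        open ≤-Reasoning
        rearrange : ∀ c s a b f → c + (s + (a + (b + f))) ≡ (s + a) + (f + (c + b))
        rearrange = solve 5 (λ c s a b f → c :+ (s :+ (a :+ (b :+ f))) := (s :+ a) :+ (f :+ (c :+ b))) refl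

      fresh-columns : ∃ λ ys → length ys ≡ length stuck × Unique ys × All (_∉ avoid) ys
      fresh-columns with drop≡[]⊎length-drop (length onlyV) blocked
      ... | inj₁ stuck≡[] = [] , cong length (sym stuck≡[]) , [] , []
      ... | inj₂ stuck+onlyV≡blocked = fresh avoid (length stuck) (room-for-columns stuck+onlyV≡blocked)

      columns : List (Fin q)
      columns = proj₁ fresh-columns

      length-columns : length columns ≡ length stuck
      length-columns = proj₁ (proj₂ fresh-columns)

      columns-unoccupied : ∀ {y} → y ∈ columns → ¬ Occupied y × ¬ Blocked y
      columns-unoccupied y∈ = let y∉ = All.lookup (proj₂ (proj₂ (proj₂ fresh-columns))) y∈ in
        (λ occ → y∉ (∈-filter⁺ _ (∈-allFin _) (inj₁ occ))) , (λ b → y∉ (∈-filter⁺ _ (∈-allFin _) (inj₂ b)))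

      -- A descent (x , y) takes the leftover source top x along the fibre to top y and down to bottom y.
      descents : List (Fin q × Fin q)
      descents = zip stuck columns ++ map diagonal clear

      map-diagonal : ∀ (f : Fin q × Fin q → Fin q) → (∀ x → f (diagonal x) ≡ x) → map f (map diagonal clear) ≡ clear
      map-diagonal f f∘diagonal = trans (sym (map-∘ clear)) (trans (map-cong f∘diagonal clear) (map-id clear))

      firsts-descents : map proj₁ descents ≡ leftover
      firsts-descents = begin
        map proj₁ descents                                          ≡⟨ map-++ proj₁ (zip stuck columns) _ ⟩
        map proj₁ (zip stuck columns) ++ map proj₁ (map diagonal clear)
          ≡⟨ cong₂ _++_ (map-proj₁-zip stuck columns (sym length-columns)) (map-diagonal proj₁ (λ _ → refl)) ⟩
        stuck ++ clear                                              ≡⟨ sym leftover≡ ⟩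
        leftover                                                    ∎
        where open ≡-Reasoning

      seconds-descents : map proj₂ descents ≡ columns ++ clear
      seconds-descents = trans (map-++ proj₂ (zip stuck columns) _)
                               (cong₂ _++_ (map-proj₂-zip stuck columns (sym length-columns)) (map-diagonal proj₂ (λ _ → refl)))

      DescentPair : Fin q × Fin q → Set
      DescentPair (x , y) = x ∈ leftover × (y ≡ x ⊎ ¬ Occupied y) × ¬ Blocked y

      descent-pair : ∀ {xy} → xy ∈ descents → DescentPair xy
      descent-pair xy∈ with ∈-++⁻ (zip stuck columns) xy∈
      ... | inj₁ xy∈zip = let x∈ , y∈ = ∈-zip⁻ xy∈zip ; ¬occ , ¬b = columns-unoccupied y∈ in
                          subst (_ ∈_) (sym leftover≡) (∈-++⁺ˡ x∈) , inj₂ ¬occ , ¬b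
      ... | inj₂ xy∈diag with ∈-map⁻ diagonal xy∈diag
      ...   | x , x∈ , refl = subst (_ ∈_) (sym leftover≡) (∈-++⁺ʳ stuck x∈) , inj₁ refl
                            , proj₂ (∈-unblocked⁻ (clear⊆unblocked x∈))

      occupied-source : ∀ {x y} → (x , y) ∈ descents → Occupied x
      occupied-source xy∈ = onlyU-occupied (leftover⊆onlyU (proj₁ (descent-pair xy∈)))

      columns! : Unique columns
      columns! = proj₁ (proj₂ (proj₂ fresh-columns))

      seconds! : Unique (map proj₂ descents)
      seconds! = subst Unique (sym seconds-descents)
        (Uniqueₚ.++⁺ columns! (Uniqueₚ.drop⁺ (length onlyV ∸ length blocked) (Uniqueₚ.filter⁺ (¬? ∘ Blocked?) onlyU!))
          λ (y∈ , y∈′) → proj₁ (columns-unoccupied y∈) (onlyU-occupied (proj₁ (∈-unblocked⁻ (clear⊆unblocked y∈′)))))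

      firsts! : Unique (map proj₁ descents)
      firsts! = subst Unique (sym firsts-descents) (Uniqueₚ.drop⁺ (length onlyV) order!)

      U′ : List Point
      U′ = lower U ++ map bottom (map proj₂ descents)

      lower⊆ : ∀ {W} → lower W ⊆ W
      lower⊆ {W} = proj₁ ∘ ∈-filter⁻ _ {xs = W}

      lower-over : ∀ {W} → All (Over (h ∷ hs)) W → All (Over hs) (lower W)
      lower-over {W} W-over = All.tabulate λ p∈ → let p∈W , k≢h = ∈-filter⁻ _ {xs = W} p∈ in case (All.lookup W-over p∈W) k≢h
        where
        case : ∀ {k} → k ∈ h ∷ hs → ¬ k ≡ h → k ∈ hs
        case (here k≡h) k≢h = ⊥-elim (k≢h k≡h)
        case (there k∈hs) _ = k∈hs

      U′! : Unique U′
      U′! = Uniqueₚ.++⁺ (Uniqueₚ.filter⁺ _ U!) (Uniqueₚ.map⁺ bottom-injective seconds!)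
                        λ (p∈ , p∈′) → bottom-blocked (lower⊆ p∈) p∈′
        where
        bottom-blocked : ∀ {p} → p ∈ U → ¬ p ∈ map bottom (map proj₂ descents)
        bottom-blocked p∈U p∈ with ∈-map⁻ bottom p∈
        ... | y , y∈ , refl with ∈-map⁻ proj₂ y∈
        ...   | (x , .y) , xy∈ , refl = proj₂ (proj₂ (descent-pair xy∈)) p∈U

      U′-over : All (Over hs) U′
      U′-over = Allₚ.++⁺ (lower-over U-over)
                         (All.tabulate λ p∈ → let _ , _ , p≡ = ∈-map⁻ bottom p∈ in subst (Over hs) (sym p≡) h′∈hs)

      length-U′ : length U′ ≡ length (lower V)
      length-U′ = +-cancelʳ-≡ (length shared + length onlyV) _ _ (begin
        length U′ + (length shared + length onlyV)
          ≡⟨ cong (_+ (length shared + length onlyV)) (trans (length-++ (lower U)) (cong (length (lower U) +_) length-bottoms)) ⟩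
        length (lower U) + length leftover + (length shared + length onlyV)
          ≡⟨ rearrange (length (lower U)) (length leftover) (length shared) (length onlyV) ⟩
        length (lower U) + (length shared + (length leftover + length onlyV))
          ≡⟨ cong (λ n → length (lower U) + (length shared + n)) (trans (length-drop-length order onlyV room′) length-order) ⟩
        length (lower U) + (length shared + length onlyU)
          ≡⟨ trans (sym length-U) (trans |U|≡|V| length-V) ⟩
        length (lower V) + (length shared + length onlyV) ∎)
        where
        open ≡-Reasoning
        room′ : length onlyV ≤ length order
        room′ = subst (length onlyV ≤_) (sym length-order) room
        length-bottoms : length (map bottom (map proj₂ descents)) ≡ length leftover
        length-bottoms = begin
          length (map bottom (map proj₂ descents)) ≡⟨ length-map bottom (map proj₂ descents) ⟩
          length (map proj₂ descents)              ≡⟨ length-map proj₂ descents ⟩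
          length descents                          ≡⟨ sym (length-map proj₁ descents) ⟩
          length (map proj₁ descents)              ≡⟨ cong length firsts-descents ⟩
          length leftover                          ∎
        rearrange : ∀ u l s v → u + l + (s + v) ≡ u + (s + (l + v))
        rearrange = solve 4 (λ u l s v → u :+ l :+ (s :+ v) := u :+ (s :+ (l :+ v))) refl

      innerLinkage : Linkage hs U′ (lower V)
      innerLinkage = IH U′ (lower V) U′! (Uniqueₚ.filter⁺ off-top? V!) U′-over (lower-over V-over) length-U′
                 (subst (_≤ q) (sym length-U′) (≤-trans (length-filter off-top? V) (subst (_≤ q) |U|≡|V| |U|≤q)))

      data Start (s : Point) : Set where
        kept : s ∈ lower U → Start s
        descended : ∀ {x y} → (x , y) ∈ descents → s ≡ bottom y → Start s

      start : ∀ {s} → s ∈ U′ → Start s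
      start s∈ with ∈-++⁻ (lower U) s∈
      ... | inj₁ s∈lower = kept s∈lower
      ... | inj₂ s∈bottom with ∈-map⁻ bottom s∈bottom
      ...   | y , y∈ , refl with ∈-map⁻ proj₂ y∈
      ...     | (x , .y) , xy∈ , refl = descended xy∈ refl

      extendFrom : ∀ {s t} → Start s → t ∈ lower V → Walk s t → Link U V
      extendFrom (kept s∈) t∈ w = link (lower⊆ s∈) (lower⊆ t∈) w
      extendFrom (descended xy∈ refl) t∈ w =
        link (proj₁ (∈-onlyU⁻ (leftover⊆onlyU (proj₁ (descent-pair xy∈))))) (lower⊆ t∈) (fibre ◅ column r ◅ w)

      extend : Link U′ (lower V) → Link U V
      extend l = extendFrom (start (source∈ l)) (target∈ l) (walk l)

      AddedTop : Point → Point → Set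
      AddedTop s p = ∃ λ x → ∃ λ y → (x , y) ∈ descents × s ≡ bottom y × (p ≡ top x ⊎ p ≡ top y)

      points-extendFrom : ∀ {s t} (st : Start s) (t∈ : t ∈ lower V) (w : Walk s t) {p} →
                          p ∈ points (extendFrom st t∈ w) → p ∈ vertices w ⊎ AddedTop s p
      points-extendFrom (kept _) _ _ p∈ = inj₁ p∈
      points-extendFrom (descended xy∈ refl) _ _ (here refl) = inj₂ (_ , _ , xy∈ , refl , inj₁ refl)
      points-extendFrom (descended xy∈ refl) _ _ (there (here refl)) = inj₂ (_ , _ , xy∈ , refl , inj₂ refl)
      points-extendFrom (descended _ refl) _ _ (there (there p∈)) = inj₁ p∈

      points-extend : ∀ l {p} → p ∈ points (extend l) → p ∈ points l ⊎ AddedTop (source l) p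
      points-extend l = points-extendFrom (start (source∈ l)) (target∈ l) (walk l)

      same-first⇒same-column : ∀ {x₁ y₁ x₂ y₂} → (x₁ , y₁) ∈ descents → (x₂ , y₂) ∈ descents → x₁ ≡ x₂ → y₁ ≡ y₂
      same-first⇒same-column xy₁∈ xy₂∈ x₁≡x₂ = cong proj₂ (Unique-map⇒injective proj₁ firsts! xy₁∈ xy₂∈ x₁≡x₂)

      occupied-column⇒diagonal : ∀ {x y} → (x , y) ∈ descents → Occupied y → y ≡ x
      occupied-column⇒diagonal xy∈ occupied with proj₁ (proj₂ (descent-pair xy∈))
      ... | inj₁ y≡x = y≡x
      ... | inj₂ ¬occupied = ⊥-elim (¬occupied occupied)

      same-column : ∀ {x₁ y₁ x₂ y₂ p} → (x₁ , y₁) ∈ descents → (x₂ , y₂) ∈ descents →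
                    p ≡ top x₁ ⊎ p ≡ top y₁ → p ≡ top x₂ ⊎ p ≡ top y₂ → y₁ ≡ y₂
      same-column xy₁∈ xy₂∈ (inj₁ refl) (inj₁ eq) = same-first⇒same-column xy₁∈ xy₂∈ (top-injective eq)
      same-column xy₁∈ xy₂∈ (inj₁ refl) (inj₂ eq) = same-first⇒same-column xy₁∈ xy₂∈
        (trans (top-injective eq) (occupied-column⇒diagonal xy₂∈ (subst Occupied (top-injective eq) (occupied-source xy₁∈))))
      same-column xy₁∈ xy₂∈ (inj₂ refl) (inj₁ eq) = same-first⇒same-column xy₁∈ xy₂∈
        (trans (sym (occupied-column⇒diagonal xy₁∈ (subst Occupied (sym (top-injective eq)) (occupied-source xy₂∈))))
               (top-injective eq))
      same-column _ _ (inj₂ refl) (inj₂ eq) = top-injective eq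

      added-top-not-over : ∀ {s p} → Over hs p → AddedTop s p → ⊥
      added-top-not-over h∈hs (_ , _ , _ , _ , inj₁ refl) = h∉hs h∈hs
      added-top-not-over h∈hs (_ , _ , _ , _ , inj₂ refl) = h∉hs h∈hs

      extend-disjoint : ∀ l l′ → All (Over hs) (points l) → All (Over hs) (points l′) → Disjointᴸ (points l) (points l′) →
                        Disjointᴸ (points (extend l)) (points (extend l′))
      extend-disjoint l l′ over over′ l∩l′ (p∈ , p∈′) = apart (points-extend l p∈) (points-extend l′ p∈′)
        where
        apart : ∀ {p} → p ∈ points l ⊎ AddedTop (source l) p → p ∈ points l′ ⊎ AddedTop (source l′) p → ⊥
        apart (inj₁ p∈l) (inj₁ p∈l′) = l∩l′ (p∈l , p∈l′)
        apart (inj₁ p∈l) (inj₂ added) = added-top-not-over (All.lookup over p∈l) added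
        apart (inj₂ added) (inj₁ p∈l′) = added-top-not-over (All.lookup over′ p∈l′) added
        apart (inj₂ (_ , _ , xy₁∈ , s≡ , p≡)) (inj₂ (_ , _ , xy₂∈ , s≡′ , p≡′)) =
          l∩l′ ( subst (_∈ points l) s≡ (source∈vertices (walk l))
               , subst (λ y → bottom y ∈ points l′) (sym (same-column xy₁∈ xy₂∈ p≡ p≡′))
                       (subst (_∈ points l′) s≡′ (source∈vertices (walk l′))))

      extend-free : ∀ l → All (Over hs) (points l) → All (Free leftover) (points (extend l))
      extend-free l over = All.tabulate λ p∈ → free (points-extend l p∈)
        where
        free : ∀ {p} → p ∈ points l ⊎ AddedTop (source l) p → Free leftover p
        free (inj₁ p∈l) = inj₁ (All.lookup over p∈l)
        free (inj₂ (_ , _ , xy∈ , _ , inj₁ refl)) = inj₂ (refl , inj₁ (proj₁ (descent-pair xy∈)))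
        free (inj₂ (_ , _ , xy∈ , _ , inj₂ refl)) with proj₁ (proj₂ (descent-pair xy∈))
        ... | inj₁ refl = inj₂ (refl , inj₁ (proj₁ (descent-pair xy∈)))
        ... | inj₂ ¬occupied = inj₂ (refl , inj₂ ¬occupied)

      descent : Descent leftover
      descent =
        let ls , length-ls , over , disjoint = innerLinkage in
          map extend ls
        , trans (length-map extend ls) (trans length-ls length-U′)
        , Allₚ.map⁺ (All.map (λ {l} → extend-free l) over)
        , AllPairsₚ.map⁺ (AllPairs.map (λ {l} {l′} (o , o′ , d) {p} → extend-disjoint l l′ o o′ d {p})
                                       (AllPairs-All {R = Disjointᴸ on points} over disjoint))

      linkage : Linkage (h ∷ hs) U V
      linkage = assemble topMatching descent

    linkage-top : hs ≡ [] ⊎ (∃ λ k → k ∈ hs × R h k) → Linked hs → length onlyV ≤ length onlyU → Linkage (h ∷ hs) U V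
    linkage-top (inj₁ hs≡[]) _ room = linkage-base hs≡[] room
    linkage-top (inj₂ (h′ , h′∈hs , r)) IH room = Descend.linkage h′ h′∈hs r IH room

  linkage-step : ∀ {h hs} → h ∉ hs → hs ≡ [] ⊎ (∃ λ k → k ∈ hs × R h k) → Linked hs → Linked (h ∷ hs)
  linkage-step h∉hs neighbour IH U V U! V! U-over V-over |U|≡|V| |U|≤q = by-size (length onlyV ≤? length onlyU)
    where
    open TopFibre _ _ h∉hs U V U! V! U-over V-over |U|≡|V| |U|≤q
    module Flipped = TopFibre _ _ h∉hs V U V! U! V-over U-over (sym |U|≡|V|) (subst (_≤ q) |U|≡|V| |U|≤q)
    by-size : Dec (length onlyV ≤ length onlyU) → Linkage _ U V
    by-size (yes room) = linkage-top neighbour IH room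
    by-size (no ¬room) = linkage-flip |U|≡|V| (Flipped.linkage-top neighbour IH (<⇒≤ (≰⇒> ¬room)))

  linked : ∀ {hs} → ConnectedOrder R hs → Linked hs
  linked [] [] [] _ _ _ _ _ _ = [] , refl , [] , []
  linked [] (_ ∷ _) _ _ _ (() ∷ _) _ _ _
  linked (grow h∉hs neighbour order) = linkage-step h∉hs neighbour (linked order)

-- Hamming graphs

record Close {A : Set} {n} (xs ys : Vec A n) : Set where
  constructor close
  field
    position : Fin n
    agree : ∀ k → k ≢ position → lookup xs k ≡ lookup ys k
open Close public

module _ {A : Set} where

  Close-sym : ∀ {n} {xs ys : Vec A n} → Close xs ys → Close ys xs
  Close-sym (close j agree) = close j λ k k≢j → sym (agree k k≢j)

  Close-refl : ∀ {n} {xs : Vec A (suc n)} → Close xs xs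
  Close-refl = close fzero λ _ _ → refl

  Close-∷ : ∀ {n x} {xs ys : Vec A n} → Close xs ys → Close (x ∷ xs) (x ∷ ys)
  Close-∷ (close j agree) = close (fsuc j) λ { fzero _ → refl ; (fsuc k) k≢j → agree k (λ k≡j → k≢j (cong fsuc k≡j)) }

  Close-head : ∀ {n x y} {xs : Vec A n} → Close (x ∷ xs) (y ∷ xs)
  Close-head = close fzero λ { fzero 0≢0 → ⊥-elim (0≢0 refl) ; (fsuc k) _ → refl }

  Close? : DecidableEquality A → ∀ {n} → Decidable (Close {A} {n})
  Close? _≟_ xs ys = map′ (λ (j , agree) → close j agree) (λ (close j agree) → j , agree)
    (any? λ j → all? λ k → ¬? (k ≟ᶠ j) →-dec (lookup xs k ≟ lookup ys k))

module Vectors (q : ℕ) where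

  vectors : ∀ m → List (Vec (Fin q) m)
  vectors zero = [] ∷ []
  vectors (suc m) = cartesianProductWith _∷_ (allFin q) (vectors m)

  ∈-vectors : ∀ {m} (v : Vec (Fin q) m) → v ∈ vectors m
  ∈-vectors [] = here refl
  ∈-vectors (x ∷ v) = ∈-cartesianProductWith⁺ _∷_ (∈-allFin x) (∈-vectors v)

  connected-++ : ∀ {m} x {L : List (Vec (Fin q) m)} {T : List (Vec (Fin q) (suc m))} →
                 ConnectedOrder Close L → ConnectedOrder Close T →
                 (∀ {v} → x ∷ v ∉ T) → (∀ v → T ≡ [] ⊎ ∃ λ y → y ∷ v ∈ T) → ConnectedOrder Close (map (x ∷_) L ++ T)
  connected-++ x [] T-connected _ _ = T-connected
  connected-++ x {v ∷ L} {T} (grow v∉L neighbour L-connected) T-connected x∉T reach =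
    grow x∷v∉ (neighbour′ neighbour) (connected-++ x L-connected T-connected x∉T reach)
    where
    x∷v∉ : x ∷ v ∉ map (x ∷_) L ++ T
    x∷v∉ x∷v∈ with ∈-++⁻ (map (x ∷_) L) x∷v∈
    ... | inj₁ x∷v∈L with ∈-map⁻ (x ∷_) x∷v∈L
    ...   | _ , v∈L , refl = v∉L v∈L
    x∷v∉ x∷v∈ | inj₂ x∷v∈T = x∉T x∷v∈T
    neighbour′ : L ≡ [] ⊎ (∃ λ w → w ∈ L × Close v w) →
                 map (x ∷_) L ++ T ≡ [] ⊎ (∃ λ w → w ∈ map (x ∷_) L ++ T × Close (x ∷ v) w)
    neighbour′ (inj₂ (w , w∈L , v~w)) = inj₂ (x ∷ w , ∈-++⁺ˡ (∈-map⁺ (x ∷_) w∈L) , Close-∷ v~w)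
    neighbour′ (inj₁ refl) with reach v
    ... | inj₁ T≡[] = inj₁ T≡[]
    ... | inj₂ (y , y∷v∈T) = inj₂ (y ∷ v , y∷v∈T , Close-head)

  vectors-connected : ∀ m → ConnectedOrder Close (vectors m)
  vectors-connected zero = grow (λ ()) (inj₁ refl) []
  vectors-connected (suc m) = prefixes (allFin q) (allFin⁺ q)
    where
    reach : ∀ xs v → cartesianProductWith _∷_ xs (vectors m) ≡ [] ⊎ ∃ λ y → y ∷ v ∈ cartesianProductWith _∷_ xs (vectors m)
    reach [] _ = inj₁ refl
    reach (y ∷ ys) v = inj₂ (y , ∈-cartesianProductWith⁺ _∷_ {xs = y ∷ ys} (here refl) (∈-vectors v))
    prefixes : ∀ xs → Unique xs → ConnectedOrder Close (cartesianProductWith _∷_ xs (vectors m))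
    prefixes [] _ = []
    prefixes (x ∷ xs) (x∉xs ∷ xs!) = connected-++ x (vectors-connected m) (prefixes xs xs!) x∷v∉ (reach xs)
      where
      x∷v∉ : ∀ {v} → x ∷ v ∉ cartesianProductWith _∷_ xs (vectors m)
      x∷v∉ x∷v∈ with ∈-cartesianProductWith⁻ _∷_ xs (vectors m) x∷v∈
      ... | _ , _ , x∈xs , _ , eq = All¬⇒¬Any x∉xs (subst (_∈ xs) (sym (proj₁ (∷-injective eq))) x∈xs)

module _ {A : Set} where

  lookup-∷ʳ-inject₁ : ∀ {n} (xs : Vec A n) a j → lookup (xs ∷ʳ a) (inject₁ j) ≡ lookup xs j
  lookup-∷ʳ-inject₁ (x ∷ xs) a fzero = refl
  lookup-∷ʳ-inject₁ (x ∷ xs) a (fsuc j) = lookup-∷ʳ-inject₁ xs a j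

  lookup-∷ʳ-fromℕ : ∀ {n} (xs : Vec A n) a → lookup (xs ∷ʳ a) (fromℕ n) ≡ a
  lookup-∷ʳ-fromℕ [] a = refl
  lookup-∷ʳ-fromℕ (x ∷ xs) a = lookup-∷ʳ-fromℕ xs a

  []≔-∷ʳ-inject₁ : ∀ {n} (xs : Vec A n) a j b → (xs ∷ʳ a) [ inject₁ j ]≔ b ≡ (xs [ j ]≔ b) ∷ʳ a
  []≔-∷ʳ-inject₁ (x ∷ xs) a fzero b = refl
  []≔-∷ʳ-inject₁ (x ∷ xs) a (fsuc j) b = cong (x ∷_) ([]≔-∷ʳ-inject₁ xs a j b)

  []≔-∷ʳ-fromℕ : ∀ {n} (xs : Vec A n) a b → (xs ∷ʳ a) [ fromℕ n ]≔ b ≡ xs ∷ʳ b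
  []≔-∷ʳ-fromℕ [] a b = refl
  []≔-∷ʳ-fromℕ (x ∷ xs) a b = cong (x ∷_) ([]≔-∷ʳ-fromℕ xs a b)

  map-just-injective : ∀ {n} {xs ys : Vec A n} → Vec.map just xs ≡ Vec.map just ys → xs ≡ ys
  map-just-injective {xs = []} {[]} _ = refl
  map-just-injective {xs = _ ∷ _} {_ ∷ _} eq with ∷-injective eq
  ... | refl , eq′ = cong (_ ∷_) (map-just-injective eq′)

  all-just : ∀ {n} (v : Vec (Maybe A) n) → (∀ k → lookup v k ≢ nothing) → ∃ λ xs → v ≡ Vec.map just xs
  all-just [] _ = [] , refl
  all-just (nothing ∷ v) no-nothing = ⊥-elim (no-nothing fzero refl)
  all-just (just x ∷ v) no-nothing with all-just v (λ k → no-nothing (fsuc k))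
  ... | xs , refl = x ∷ xs , refl

fromℕ-or-inject₁ : ∀ {n} (k : Fin (suc n)) → k ≡ fromℕ n ⊎ ∃ λ j → k ≡ inject₁ j
fromℕ-or-inject₁ {zero} fzero = inj₁ refl
fromℕ-or-inject₁ {suc n} fzero = inj₂ (fzero , refl)
fromℕ-or-inject₁ {suc n} (fsuc k) with fromℕ-or-inject₁ k
... | inj₁ refl = inj₁ refl
... | inj₂ (j , refl) = inj₂ (fsuc j , refl)

-- The hypergraph H_q^r, for r = m + 2

module Hypergraph (q m : ℕ) where

  Word : Set
  Word = Vec (Fin q) (suc m)

  Vertex : Set
  Vertex = Tuple q (suc (suc m))

  -- uVertex p is the vertex (p , α) of U_r, edgeAt i p the edge indexed by (p , i), and
  -- wVertex i p j the vertex of that edge in W_i with α at position j.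
  uVertex : Word → Vertex
  uVertex p = Vec.map just p ∷ʳ nothing

  edgeAt : Fin q → Word → EdgeIx q (suc (suc m))
  edgeAt i p = p ∷ʳ i

  punch : Word → Fin (suc m) → Vec (Maybe (Fin q)) (suc m)
  punch p j = Vec.map just p [ j ]≔ nothing

  wVertex : Fin q → Word → Fin (suc m) → Vertex
  wVertex i p j = punch p j ∷ʳ just i

  punch-edgeAt-fromℕ : ∀ i p → Vec.map just (edgeAt i p) [ fromℕ (suc m) ]≔ nothing ≡ uVertex p
  punch-edgeAt-fromℕ i p =
    trans (cong (_[ fromℕ (suc m) ]≔ nothing) (map-∷ʳ just i p)) ([]≔-∷ʳ-fromℕ (Vec.map just p) (just i) nothing)

  punch-edgeAt-inject₁ : ∀ i p j → Vec.map just (edgeAt i p) [ inject₁ j ]≔ nothing ≡ wVertex i p j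
  punch-edgeAt-inject₁ i p j =
    trans (cong (_[ inject₁ j ]≔ nothing) (map-∷ʳ just i p)) ([]≔-∷ʳ-inject₁ (Vec.map just p) (just i) j nothing)

  uVertex∈edgeAt : ∀ i p → uVertex p ∈ₑ edgeAt i p
  uVertex∈edgeAt i p = fromℕ (suc m) , sym (punch-edgeAt-fromℕ i p)

  wVertex∈edgeAt : ∀ i p j → wVertex i p j ∈ₑ edgeAt i p
  wVertex∈edgeAt i p j = inject₁ j , sym (punch-edgeAt-inject₁ i p j)

  ∈edgeAt⁻ : ∀ {i p v} → v ∈ₑ edgeAt i p → v ≡ uVertex p ⊎ ∃ λ j → v ≡ wVertex i p j
  ∈edgeAt⁻ {i} {p} (k , refl) with fromℕ-or-inject₁ k
  ... | inj₁ refl = inj₁ (punch-edgeAt-fromℕ i p)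
  ... | inj₂ (j , refl) = inj₂ (j , punch-edgeAt-inject₁ i p j)

  last-index : ∀ {j : Fin (suc (suc m))} → suc (toℕ j) ≡ suc (suc m) → j ≡ fromℕ (suc m)
  last-index eq = toℕ-injective (trans (suc-injective eq) (sym (toℕ-fromℕ (suc m))))

  LastIs-∷ʳ : ∀ {A : Set} (xs : Vec A (suc m)) a → LastIs (xs ∷ʳ a) a
  LastIs-∷ʳ xs a j eq = subst (λ k → lookup (xs ∷ʳ a) k ≡ a) (sym (last-index eq)) (lookup-∷ʳ-fromℕ xs a)

  LastIs⇒lookup : ∀ {A : Set} {v : Vec A (suc (suc m))} {a} → LastIs v a → lookup v (fromℕ (suc m)) ≡ a
  LastIs⇒lookup last = last (fromℕ (suc m)) (cong suc (toℕ-fromℕ (suc m)))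

  LastIs-unique : ∀ {A : Set} (v : Vec A (suc (suc m))) {a b} → LastIs v a → LastIs v b → a ≡ b
  LastIs-unique v last-a last-b = trans (sym (LastIs⇒lookup {v = v} last-a)) (LastIs⇒lookup {v = v} last-b)

  lookup-punch : ∀ p {j k} → k ≢ j → lookup (punch p j) k ≡ just (lookup p k)
  lookup-punch p {j} {k} k≢j = trans (lookup∘update′ k≢j (Vec.map just p) nothing) (lookup-map k just p)

  nothing≢just : ∀ {x : Fin q} → nothing ≢ just x
  nothing≢just ()

  uVertex-vertex : ∀ p → IsVertex (uVertex p)
  uVertex-vertex p = fromℕ (suc m) , lookup-∷ʳ-fromℕ (Vec.map just p) nothing , just-elsewhere
    where
    just-elsewhere : ∀ k → k ≢ fromℕ (suc m) → lookup (uVertex p) k ≢ nothing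
    just-elsewhere k k≢last with fromℕ-or-inject₁ k
    ... | inj₁ k≡last = ⊥-elim (k≢last k≡last)
    ... | inj₂ (j , refl) =
      nothing≢just ∘ sym ∘ trans (sym (trans (lookup-∷ʳ-inject₁ (Vec.map just p) nothing j) (lookup-map j just p)))

  wVertex-vertex : ∀ i p j → IsVertex (wVertex i p j)
  wVertex-vertex i p j =
    inject₁ j , trans (lookup-∷ʳ-inject₁ (punch p j) (just i) j) (lookup∘update j (Vec.map just p) nothing) , just-elsewhere
    where
    just-elsewhere : ∀ k → k ≢ inject₁ j → lookup (wVertex i p j) k ≢ nothing
    just-elsewhere k k≢j with fromℕ-or-inject₁ k
    ... | inj₁ refl = nothing≢just ∘ sym ∘ trans (sym (lookup-∷ʳ-fromℕ (punch p j) (just i)))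
    ... | inj₂ (k′ , refl) =
      nothing≢just ∘ sym ∘ trans (sym (trans (lookup-∷ʳ-inject₁ (punch p j) (just i) k′) (lookup-punch p (k≢j ∘ cong inject₁))))

  uVertex-in-layer : ∀ i p → InWiUr i (uVertex p)
  uVertex-in-layer i p = uVertex-vertex p , inj₂ (LastIs-∷ʳ (Vec.map just p) nothing)

  wVertex-in-layer : ∀ i p j → InWiUr i (wVertex i p j)
  wVertex-in-layer i p j = wVertex-vertex i p j , inj₁ (LastIs-∷ʳ (punch p j) (just i))

  edgeAt-in-layer : ∀ i p → EdgeInHi i (edgeAt i p)
  edgeAt-in-layer i p v v∈ with ∈edgeAt⁻ v∈
  ... | inj₁ refl = uVertex-in-layer i p
  ... | inj₂ (j , refl) = wVertex-in-layer i p j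

  punch-injective⇒Close : ∀ {p p′ j j′} → punch p j ≡ punch p′ j′ → Close p p′
  punch-injective⇒Close {p} {p′} {j} {j′} eq with j ≟ᶠ j′
  ... | no j≢j′ = ⊥-elim (nothing≢just (trans (sym (lookup∘update j (Vec.map just p) nothing))
                                             (trans (cong (λ v → lookup v j) eq) (lookup-punch p′ j≢j′))))
  ... | yes refl = close j λ k k≢j →
    just-injective (trans (sym (lookup-punch p k≢j)) (trans (cong (λ v → lookup v k) eq) (lookup-punch p′ k≢j)))

  punch-Close : ∀ {p p′} (c : Close p p′) → punch p (position c) ≡ punch p′ (position c)
  punch-Close {p} {p′} (close j agree) = trans (sym (tabulate∘lookup _)) (trans (tabulate-cong same) (tabulate∘lookup _))
    where
    same : ∀ k → lookup (punch p j) k ≡ lookup (punch p′ j) k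
    same k with k ≟ᶠ j
    ... | yes refl = trans (lookup∘update k (Vec.map just p) nothing) (sym (lookup∘update k (Vec.map just p′) nothing))
    ... | no k≢j = trans (lookup-punch p k≢j) (trans (cong just (agree k k≢j)) (sym (lookup-punch p′ k≢j)))

  shared-vertex⇒Close : ∀ {i p p′ x} → x ∈ₑ edgeAt i p → x ∈ₑ edgeAt i p′ → Close p p′
  shared-vertex⇒Close x∈ x∈′ with ∈edgeAt⁻ x∈ | ∈edgeAt⁻ x∈′
  ... | inj₁ refl | inj₁ eq = subst (Close _) (map-just-injective (∷ʳ-injectiveˡ _ _ eq)) Close-refl
  ... | inj₁ refl | inj₂ (_ , eq) = ⊥-elim (nothing≢just (∷ʳ-injectiveʳ _ _ eq))
  ... | inj₂ (_ , refl) | inj₁ eq = ⊥-elim (nothing≢just (sym (∷ʳ-injectiveʳ _ _ eq)))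
  ... | inj₂ (_ , refl) | inj₂ (_ , eq) = punch-injective⇒Close (∷ʳ-injectiveˡ _ _ eq)

  shared-vertex⇒≡ : ∀ {i i′ p p′ x} → i ≢ i′ → x ∈ₑ edgeAt i p → x ∈ₑ edgeAt i′ p′ → p ≡ p′
  shared-vertex⇒≡ i≢i′ x∈ x∈′ with ∈edgeAt⁻ x∈ | ∈edgeAt⁻ x∈′
  ... | inj₁ refl | inj₁ eq = map-just-injective (∷ʳ-injectiveˡ _ _ eq)
  ... | inj₁ refl | inj₂ (_ , eq) = ⊥-elim (nothing≢just (∷ʳ-injectiveʳ _ _ eq))
  ... | inj₂ (_ , refl) | inj₁ eq = ⊥-elim (nothing≢just (sym (∷ʳ-injectiveʳ _ _ eq)))
  ... | inj₂ (_ , refl) | inj₂ (_ , eq) = ⊥-elim (i≢i′ (just-injective (∷ʳ-injectiveʳ _ _ eq)))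

  InUr⇒uVertex : ∀ {u : Vertex} → InUr u → ∃ λ p → u ≡ uVertex p
  InUr⇒uVertex {u} ((j , _ , just-elsewhere) , last-nothing) with initLast u
  ... | init , a , refl = let p , init≡ = all-just init just-in-init in p , cong₂ _∷ʳ_ init≡ a≡nothing
    where
    a≡nothing : a ≡ nothing
    a≡nothing = LastIs-unique (init ∷ʳ a) (LastIs-∷ʳ init a) last-nothing
    just-in-init : ∀ k → lookup init k ≢ nothing
    just-in-init k eq with inject₁ k ≟ᶠ j
    ... | no k≢j = just-elsewhere (inject₁ k) k≢j (trans (lookup-∷ʳ-inject₁ init a k) eq)
    ... | yes refl = just-elsewhere (fromℕ (suc m)) fromℕ≢inject₁ (trans (lookup-∷ʳ-fromℕ init a) a≡nothing)

  module Layer (i : Fin q) where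

    -- The path enters the edge of its first word at uVertex, passes from each edge to the next
    -- through their common vertex in W_i, and leaves the edge of its last word at uVertex.
    layerVertex : ∀ {a xs c} → Chordless Close a xs c → Vertex → Fin (suc (suc (length xs))) → Vertex
    layerVertex [] v fzero = v
    layerVertex {c = c} [] v (fsuc fzero) = uVertex c
    layerVertex (_ ∷ _) v fzero = v
    layerVertex {a} ((a~b , _) ∷ p) v (fsuc k) = layerVertex p (wVertex i a (position a~b)) k

    layerPath : ∀ {a xs c} → Chordless Close a xs c → Path q (suc (suc m))
    layerPath {a} {xs} p = record
      { len = suc (length xs) ; vert = layerVertex p (uVertex a) ; edge = λ k → edgeAt i (List.lookup (a ∷ xs) k) }

    layerVertex-first : ∀ {a xs c} (p : Chordless Close a xs c) v → layerVertex p v fzero ≡ v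
    layerVertex-first [] v = refl
    layerVertex-first (_ ∷ _) v = refl

    layerVertex-last : ∀ {a xs c} (p : Chordless Close a xs c) v → layerVertex p v (fromℕ (suc (length xs))) ≡ uVertex c
    layerVertex-last [] v = refl
    layerVertex-last (_ ∷ p) v = layerVertex-last p _

    wVertex∈next : ∀ {a b} (a~b : Close a b) → wVertex i a (position a~b) ∈ₑ edgeAt i b
    wVertex∈next {a} {b} a~b =
      subst (_∈ₑ edgeAt i b) (cong (_∷ʳ just i) (sym (punch-Close a~b))) (wVertex∈edgeAt i b (position a~b))

    layerVertex∈edgeAt : ∀ {a xs c} (p : Chordless Close a xs c) v → v ∈ₑ edgeAt i a → ∀ k →
                         layerVertex p v (inject₁ k) ∈ₑ edgeAt i (List.lookup (a ∷ xs) k)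
                       × layerVertex p v (fsuc k) ∈ₑ edgeAt i (List.lookup (a ∷ xs) k)
    layerVertex∈edgeAt {a} [] v v∈ fzero = v∈ , uVertex∈edgeAt i a
    layerVertex∈edgeAt {a} ((a~b , _) ∷ p) v v∈ fzero =
      v∈ , subst (_∈ₑ edgeAt i a) (sym (layerVertex-first p _)) (wVertex∈edgeAt i a (position a~b))
    layerVertex∈edgeAt ((a~b , _) ∷ p) v v∈ (fsuc k) = layerVertex∈edgeAt p _ (wVertex∈next a~b) k

    layerVertex-in-layer : ∀ {a xs c} (p : Chordless Close a xs c) v → InWiUr i v → ∀ k → InWiUr i (layerVertex p v k)
    layerVertex-in-layer [] v v-in fzero = v-in
    layerVertex-in-layer {c = c} [] v v-in (fsuc fzero) = uVertex-in-layer i c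
    layerVertex-in-layer (_ ∷ _) v v-in fzero = v-in
    layerVertex-in-layer {a} ((a~b , _) ∷ p) v v-in (fsuc k) = layerVertex-in-layer p _ (wVertex-in-layer i a (position a~b)) k

    layerVertex-inner : ∀ {a xs c} (p : Chordless Close a xs c) v k → 0 < toℕ k → toℕ k < suc (length xs) →
                        LastIs (layerVertex p v k) (just i)
    layerVertex-inner [] v (fsuc fzero) _ (s≤s ())
    layerVertex-inner {a} ((a~b , _) ∷ p) v (fsuc fzero) _ _ =
      subst (λ w → LastIs w (just i)) (sym (layerVertex-first p _)) (LastIs-∷ʳ (punch a (position a~b)) (just i))
    layerVertex-inner (_ ∷ p) v (fsuc (fsuc k)) _ (s≤s k<) = layerVertex-inner p _ (fsuc k) (s≤s z≤n) k<

    layerPath-path : ∀ {a xs c} (p : Chordless Close a xs c) → IsPath (layerPath p)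
    layerPath-path {a} p = layerVertex∈edgeAt p (uVertex a) (uVertex∈edgeAt i a)
                         , (λ j k far x x∈ x∈′ → Chordless-nonadjacent p j k far (shared-vertex⇒Close x∈ x∈′))
                         , (λ k → proj₁ (layerVertex-in-layer p (uVertex a) (uVertex-in-layer i a) k))

    layerPath-in-layer : ∀ {a xs c} (p : Chordless Close a xs c) → PathInHi i (layerPath p)
    layerPath-in-layer {a} {xs} p = layerVertex-in-layer p (uVertex a) (uVertex-in-layer i a)
                                  , (λ k → edgeAt-in-layer i (List.lookup (a ∷ xs) k))

    layerPath-UV : ∀ {a xs c} (p : Chordless Close a xs c) {U V : List Vertex} → All InUr U → All InUr V →
                   uVertex a ∈ U → uVertex c ∈ V → IsUVPath U V (layerPath p)
    layerPath-UV {a} p {U} {V} U-in V-in a∈ c∈ =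
        layerPath-path p
      , subst (_∈ U) (sym (layerVertex-first p _)) a∈
      , subst (_∈ V) (sym (layerVertex-last p _)) c∈
      , λ k 0<k k<len → (λ v∈ → inner-not-in-Ur k 0<k k<len (proj₂ (All.lookup U-in v∈)))
                      , (λ v∈ → inner-not-in-Ur k 0<k k<len (proj₂ (All.lookup V-in v∈)))
      where
      inner-not-in-Ur : ∀ k → 0 < toℕ k → toℕ k < suc _ → ¬ LastIs (layerVertex p (uVertex a) k) nothing
      inner-not-in-Ur k 0<k k<len last-nothing
        with LastIs-unique (layerVertex p (uVertex a) k) (layerVertex-inner p (uVertex a) k 0<k k<len) last-nothing
      ... | ()

    ∈P-layerPath⁻ : ∀ {a xs c} (p : Chordless Close a xs c) {x} → x ∈P layerPath p → ∃ λ k → x ∈ₑ edgeAt i (List.lookup (a ∷ xs) k)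
    ∈P-layerPath⁻ p (inj₂ x∈edge) = x∈edge
    ∈P-layerPath⁻ {a} p (inj₁ (fzero , refl)) = fzero , proj₁ (layerVertex∈edgeAt p (uVertex a) (uVertex∈edgeAt i a) fzero)
    ∈P-layerPath⁻ {a} p (inj₁ (fsuc k , refl)) = k , proj₂ (layerVertex∈edgeAt p (uVertex a) (uVertex∈edgeAt i a) k)

  open Layer public

  layerPaths-disjoint : ∀ {i i′ a xs c a′ xs′ c′} (p : Chordless Close a xs c) (p′ : Chordless Close a′ xs′ c′) → i ≢ i′ →
                        Disjointᴸ (a ∷ xs) (a′ ∷ xs′) → Disjoint (layerPath i p) (layerPath i′ p′)
  layerPaths-disjoint {i} {i′} p p′ i≢i′ points-disjoint x x∈ x∈′ with ∈P-layerPath⁻ i p x∈ | ∈P-layerPath⁻ i′ p′ x∈′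
  ... | k , x∈k | k′ , x∈k′ = points-disjoint (∈-lookup k , subst (_∈ _) (sym (shared-vertex⇒≡ i≢i′ x∈k x∈k′)) (∈-lookup k′))

  uVertices-InUr : ∀ ps → All InUr (List.map uVertex ps)
  uVertices-InUr [] = []
  uVertices-InUr (p ∷ ps) = (uVertex-vertex p , LastIs-∷ʳ (Vec.map just p) nothing) ∷ uVertices-InUr ps

  All-InUr⇒uVertices : ∀ {W : List Vertex} → All InUr W → ∃ λ ps → W ≡ List.map uVertex ps
  All-InUr⇒uVertices [] = List.[] , refl
  All-InUr⇒uVertices {u ∷ _} (u-in ∷ W-in) with InUr⇒uVertex {u} u-in | All-InUr⇒uVertices W-in
  ... | p , refl | ps , refl = p ∷ ps , refl

-- Disjoint layered paths

module Layered (q m : ℕ) where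

  open Hypergraph q m
  open Vectors q using (vectors; ∈-vectors; vectors-connected)
  open ProductLinkage q (Vecₚ.≡-dec (_≟ᶠ_ {q})) (Close {n = m}) Close-sym

  toWord : Fin q × Vec (Fin q) m → Word
  toWord = uncurry _∷_

  toWord-injective : ∀ {a b} → toWord a ≡ toWord b → a ≡ b
  toWord-injective {_ , _} {_ , _} eq with ∷-injective eq
  ... | refl , refl = refl

  uncons-injective : ∀ {p p′ : Word} → uncons p ≡ uncons p′ → p ≡ p′
  uncons-injective {_ ∷ _} {_ ∷ _} refl = refl

  ~⇒Close : ∀ {a b} → a ~ b → Close (toWord a) (toWord b)
  ~⇒Close fibre = Close-head
  ~⇒Close (column r) = Close-∷ r

  module _ {S T : List (Fin q × Vec (Fin q) m)} where

    chordless : (l : Link S T) → ∃ λ xs → Chordless Close (toWord (source l)) xs (toWord (target l))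
                                           × toWord (source l) ∷ xs ⊆ map toWord (points l)
    chordless l with chordless-subpath (Close? _≟ᶠ_) (gmap toWord ~⇒Close (walk l))
    ... | xs , path , ⊆walk = xs , path , subst (_ ∷ xs ⊆_) (vertices-gmap toWord ~⇒Close (walk l)) ⊆walk

    chordlessPath : (l : Link S T) → Chordless Close (toWord (source l)) (proj₁ (chordless l)) (toWord (target l))
    chordlessPath l = proj₁ (proj₂ (chordless l))

    pathOf : Fin q → Link S T → Path q (suc (suc m))
    pathOf i l = layerPath i (chordlessPath l)

    paths-disjoint : ∀ {i i′} l l′ → i ≢ i′ → Disjointᴸ (points l) (points l′) → Disjoint (pathOf i l) (pathOf i′ l′)
    paths-disjoint l l′ i≢i′ l∩l′ = layerPaths-disjoint (chordlessPath l) (chordlessPath l′) i≢i′ λ (x∈ , x∈′) →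
      same-point (∈-map⁻ toWord (proj₂ (proj₂ (chordless l)) x∈)) (∈-map⁻ toWord (proj₂ (proj₂ (chordless l′)) x∈′))
      where
      same-point : ∀ {x} → ∃ (λ y → y ∈ points l × x ≡ toWord y) → ∃ (λ y → y ∈ points l′ × x ≡ toWord y) → ⊥
      same-point (_ , y∈ , refl) (_ , y∈′ , eq) = l∩l′ (y∈ , subst (_∈ points l′) (sym (toWord-injective eq)) y∈′)

    path-UV : ∀ {us vs : List Word} → (∀ {a} → a ∈ S → toWord a ∈ us) → (∀ {b} → b ∈ T → toWord b ∈ vs) →
              ∀ i l → IsUVPath (map uVertex us) (map uVertex vs) (pathOf i l)
    path-UV {us} {vs} S⊆us T⊆vs i l =
      layerPath-UV i (chordlessPath l) (uVertices-InUr us) (uVertices-InUr vs)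
                   (∈-map⁺ uVertex (S⊆us (source∈ l))) (∈-map⁺ uVertex (T⊆vs (target∈ l)))

    paths-from-links : ∀ {s} (s≤q : s ≤ q) {us vs : List Word} →
                       (∀ {a} → a ∈ S → toWord a ∈ us) → (∀ {b} → b ∈ T → toWord b ∈ vs) →
                       (ls : List (Link S T)) → length ls ≡ s → AllPairs (Disjointᴸ on points) ls →
                       Σ (Fin s → Path q (suc (suc m))) λ Q →
                         (∀ i → IsUVPath (map uVertex us) (map uVertex vs) (Q i))
                         × (∀ i → PathInHi (inject≤ i s≤q) (Q i))
                         × (∀ i j → i ≢ j → Disjoint (Q i) (Q j))
    paths-from-links s≤q S⊆us T⊆vs ls refl disjoint =
        (λ i → pathOf (inject≤ i s≤q) (List.lookup ls i))
      , (λ i → path-UV S⊆us T⊆vs (inject≤ i s≤q) (List.lookup ls i))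
      , (λ i → layerPath-in-layer (inject≤ i s≤q) (chordlessPath (List.lookup ls i)))
      , λ i j i≢j → paths-disjoint (List.lookup ls i) (List.lookup ls j) (i≢j ∘ inject≤-injective s≤q s≤q i j)
                                   (lookup-AllPairs Disjointᴸₚ.sym disjoint i j i≢j)

  takeSplit : ℕ → List Word → List (Fin q × Vec (Fin q) m)
  takeSplit s ps = map uncons (take s ps)

  takeSplit! : ∀ s {ps} → Unique ps → Unique (takeSplit s ps)
  takeSplit! s ps! = Uniqueₚ.map⁺ uncons-injective (Uniqueₚ.take⁺ s ps!)

  takeSplit-over : ∀ s ps → All (Over (vectors m)) (takeSplit s ps)
  takeSplit-over s ps = All.tabulate λ {a} _ → ∈-vectors (proj₂ a)

  length-takeSplit : ∀ {s ps} → s ≤ length ps → length (takeSplit s ps) ≡ s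
  length-takeSplit {s} {ps} s≤ = trans (length-map uncons (take s ps)) (trans (length-take s ps) (m≤n⇒m⊓n≡m s≤))

  takeSplit⊆ : ∀ s {ps a} → a ∈ takeSplit s ps → toWord a ∈ ps
  takeSplit⊆ s a∈ with ∈-map⁻ uncons a∈
  ... | _ ∷ _ , p∈ , refl = ∈-take⁻ s p∈

  layered-paths : ∀ {s} (s≤q : s ≤ q) (us vs : List Word) → Unique us → Unique vs → s ≤ length us → s ≤ length vs →
                  Σ (Fin s → Path q (suc (suc m))) λ Q →
                    (∀ i → IsUVPath (map uVertex us) (map uVertex vs) (Q i))
                    × (∀ i → PathInHi (inject≤ i s≤q) (Q i))
                    × (∀ i j → i ≢ j → Disjoint (Q i) (Q j))
  layered-paths {s} s≤q us vs us! vs! s≤us s≤vs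
    with linked (vectors-connected m) (takeSplit s us) (takeSplit s vs) (takeSplit! s us!) (takeSplit! s vs!)
                (takeSplit-over s us) (takeSplit-over s vs)
                (trans (length-takeSplit s≤us) (sym (length-takeSplit s≤vs))) (subst (_≤ q) (sym (length-takeSplit s≤us)) s≤q)
  ... | ls , length-ls , _ , disjoint =
    paths-from-links s≤q (takeSplit⊆ s) (takeSplit⊆ s) ls (trans length-ls (length-takeSplit s≤us)) disjoint

lemma6 : (q r s : ℕ) → 3 ≤ r → 1 ≤ s → (s≤q : s ≤ q) →
    (U V : List (Tuple q r)) → Unique U → Unique V →
    All InUr U → All InUr V → s ≤ length U → s ≤ length V →
    Σ (Fin s → Path q r) λ Q →
      (∀ i → IsUVPath U V (Q i))
      × (∀ i → PathInHi (inject≤ i s≤q) (Q i))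
      × (∀ i j → i ≢ j → Disjoint (Q i) (Q j))
lemma6 q (suc (suc n)) s (s≤s (s≤s _)) _ s≤q U V U! V! U-in V-in s≤|U| s≤|V|
  with Hypergraph.All-InUr⇒uVertices q n U-in | Hypergraph.All-InUr⇒uVertices q n V-in
... | us , refl | vs , refl =
  Layered.layered-paths q n s≤q us vs (Uniqueₚ.map⁻ U!) (Uniqueₚ.map⁻ V!)
    (subst (s ≤_) (length-map _ us) s≤|U|) (subst (s ≤_) (length-map _ vs) s≤|V|)
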